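{- For any string $\sigma\in 2^{<\omega}$ and any number $N \in \mathbb{N}$, there is a set $A \subseteq \mathbb{N}$ of lower density 1 such that \[ C(\sigma \mid [A]^\omega) \leq C(\sigma \mid\, \geq N) + O(1), \] where the constant hidden by the $O(1)$ does not depend on $\sigma$ or $N$.
   Context: $C$ is plain Kolmogorov complexity, $C^Y$ complexity relative to oracle $Y$, and $C(\sigma \mid n)$ the conditional complexity of $\sigma$ given $n$. $C(\sigma \mid\, \geq N) = \max_{n \geq N} C(\sigma \mid n)$. $[A]^\omega$ is the family of infinite subsets of $A$ and $C(\sigma \mid \mathcal{F}) = \max_{Y\in\mathcal{F}} C^Y(\sigma)$. The lower density of $A$ is $\liminf_{n\to\infty}\frac{|A\cap\{0,\ldots,n\}|}{n+1}$. -}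

module Defs where

-- Model of computation: oracle counter (register) machines, with a fixed
-- universal decoding of bit strings into (machine code ++ input data).
-- Plain Kolmogorov complexity is defined w.r.t. this universal oracle
-- machine U; any such choice only changes C up to an additive constant,
-- which the statement absorbs.

open import Data.Nat using (ℕ; zero; suc; _+_; _*_; _≤_; _≡ᵇ_)
open import Data.Bool using (Bool; true; false; if_then_else_)
open import Data.List using (List; []; _∷_; length)
open import Data.Maybe using (Maybe; just; nothing)
open import Data.Product using (Σ; _×_; _,_; ∃)
open import Relation.Binary.PropositionalEquality using (_≡_)
open import Data.Empty using (⊥)

BitString : Set
BitString = List Bool

Subset : Set
Subset = ℕ → Bool

-- Bijection 2^{<ω} ≅ ℕ (dyadic / length-lexicographic coding)
bit : Bool → ℕ
bit false = 0
bit true  = 1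

toℕ : BitString → ℕ
toℕ []      = 0
toℕ (b ∷ s) = suc (bit b + 2 * toℕ s)

-- inverse, via fuel = the number itself
fromℕ' : ℕ → ℕ → BitString
fromℕ' zero    _ = []
fromℕ' (suc f) zero = []
fromℕ' (suc f) (suc m) = go m
  where
  half : ℕ → ℕ
  half zero = zero
  half (suc zero) = zero
  half (suc (suc k)) = suc (half k)
  par : ℕ → Bool
  par zero = false
  par (suc zero) = true
  par (suc (suc k)) = par k
  go : ℕ → BitString
  go k = par k ∷ fromℕ' f (half k)

fromℕ : ℕ → BitString
fromℕ m = fromℕ' (suc m) m

data Instr : Set where
  inc   : (r j : ℕ) → Instr
  decjz : (r j k : ℕ) → Instr
  orc   : (r j k : ℕ) → Instr
  halt  : Instr

Prog : Set
Prog = List Instr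

Regs : Set
Regs = ℕ → ℕ

lookupI : Prog → ℕ → Instr
lookupI []       _       = halt
lookupI (i ∷ is) zero    = i
lookupI (i ∷ is) (suc n) = lookupI is n

set : Regs → ℕ → ℕ → Regs
set R r v x = if x ≡ᵇ r then v else R x

run : Subset → Prog → ℕ → Regs → ℕ → Maybe Regs
run Y P zero    R pc = nothing
run Y P (suc f) R pc with lookupI P pc
... | inc r j     = run Y P f (set R r (suc (R r))) j
... | decjz r j k with R r
...   | zero  = run Y P f R k
...   | suc v = run Y P f (set R r v) j
run Y P (suc f) R pc | orc r j k = if Y (R r) then run Y P f R j else run Y P f R k
run Y P (suc f) R pc | halt = just R

parseNat : BitString → Maybe (ℕ × BitString)
parseNat []          = nothing
parseNat (false ∷ s) = just (0 , s)
parseNat (true ∷ s) with parseNat s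
... | nothing      = nothing
... | just (k , t) = just (suc k , t)

parseArgs : ℕ → BitString → Maybe (List ℕ × BitString)
parseArgs zero    s = just ([] , s)
parseArgs (suc a) s with parseNat s
... | nothing = nothing
... | just (k , t) with parseArgs a t
...   | nothing = nothing
...   | just (ks , u) = just (k ∷ ks , u)

mkInstr : ℕ → List ℕ → Instr
mkInstr 0 (r ∷ j ∷ _)     = inc r j
mkInstr 1 (r ∷ j ∷ k ∷ _) = decjz r j k
mkInstr 2 (r ∷ j ∷ k ∷ _) = orc r j k
mkInstr _ _               = halt

arity : ℕ → ℕ
arity 0 = 2
arity 1 = 3
arity 2 = 3
arity _ = 0

-- program = (1 opcode args)* 0 ; the remaining bits are the input data.
-- fuel = length of the string (each instruction consumes ≥ 1 bit)
parseProg' : ℕ → BitString → Maybe (Prog × BitString)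
parseProg' zero    s = nothing
parseProg' (suc f) [] = nothing
parseProg' (suc f) (false ∷ s) = just ([] , s)
parseProg' (suc f) (true ∷ s) with parseNat s
... | nothing = nothing
... | just (op , t) with parseArgs (arity op) t
...   | nothing = nothing
...   | just (as , u) with parseProg' f u
...     | nothing = nothing
...     | just (P , v) = just (mkInstr op as ∷ P , v)

parseProg : BitString → Maybe (Prog × BitString)
parseProg s = parseProg' (suc (length s)) s

initRegs : BitString → ℕ → Regs
initRegs d n zero = toℕ d
initRegs d n (suc zero) = n
initRegs d n (suc (suc _)) = 0

UOut : Subset → BitString → ℕ → BitString → Set
UOut Y p n σ with parseProg p
... | nothing      = ⊥
... | just (P , d) = ∃ λ fuel → Σ Regs λ R → run Y P fuel (initRegs d n) 0 ≡ just R × fromℕ (R 0) ≡ σ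

emptyOracle : Subset
emptyOracle _ = false

CondCY≤ : Subset → BitString → ℕ → ℕ → Set
CondCY≤ Y σ n k = ∃ λ p → length p ≤ k × UOut Y p n σ

CondC≤ : BitString → ℕ → ℕ → Set
CondC≤ σ n k = CondCY≤ emptyOracle σ n k

-- C^Y(σ) ≤ k   (unconditional = condition 0)
CY≤ : Subset → BitString → ℕ → Set
CY≤ Y σ k = CondCY≤ Y σ 0 k

count : Subset → ℕ → ℕ
count A zero    = bit (A 0)
count A (suc n) = bit (A (suc n)) + count A n

-- lower density 1: for every q, eventually |A∩[0,n]|/(n+1) ≥ 1 - 1/(q+1)
LowerDensityOne : Subset → Set
LowerDensityOne A = ∀ q → ∃ λ M → ∀ n → M ≤ n → q * suc n ≤ suc q * count A n

Infinite : Subset → Set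
Infinite Y = ∀ m → ∃ λ n → m ≤ n × Y n ≡ true

_⊆_ : Subset → Subset → Set
Y ⊆ A = ∀ n → Y n ≡ true → A n ≡ true

{-# OPTIONS --safe #-}
-- Take A = {n | n ≥ N}. The least element m of an infinite Y ⊆ A satisfies
-- m ≥ N, so a program p with |p| ≤ k outputs σ on condition m. One fixed
-- oracle program Q, run on p as data, finds m by querying Y and then
-- interprets p on condition m; the code of Q is the constant c. The
-- interpreter is itself a counter machine: it keeps the simulated registers
-- as a unary-coded list in a single register and fetches each instruction by
-- re-parsing p.
module Submission where

open import Defs
open import Data.Nat using (ℕ; zero; suc; _+_; _*_; _≤_; _<_; _≡ᵇ_; z≤n; s≤s; _≤ᵇ_)
open import Data.Nat.Properties
open import Data.Bool using (Bool; true; false; if_then_else_; T; _∧_; _∨_)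
open import Data.Bool.Properties using (T-∧; T-∨)
open import Data.Unit using (⊤; tt)
open import Data.List using (List; []; _∷_; length; _++_; replicate; drop; _ʳ++_)
open import Data.List.Properties using (++-assoc; length-++; ʳ++-ʳ++; length-ʳ++)
open import Data.Maybe using (just; nothing)
open import Data.Maybe.Properties using (just-injective)
open import Data.Product using (Σ; _×_; _,_; ∃; proj₁; proj₂)
open import Data.Sum using (_⊎_; inj₁; inj₂)
open import Data.Empty using (⊥-elim)
open import Function using (_∘_; case_of_)
open import Function.Bundles using (Equivalence)
open import Relation.Binary.PropositionalEquality
open import Data.List.Relation.Unary.All using ([]; _∷_)
open import Data.List.Relation.Unary.AllPairs using (AllPairs; []; _∷_; allPairs?)
open import Relation.Nullary using (Dec; ¬?)
open import Relation.Nullary.Decidable using (from-yes)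
open import Data.Nat.Tactic.RingSolver using (solve-∀)

≡ᵇ-refl : ∀ r → (r ≡ᵇ r) ≡ true
≡ᵇ-refl zero    = refl
≡ᵇ-refl (suc r) = ≡ᵇ-refl r

≢⇒≡ᵇ-false : ∀ x r → x ≢ r → (x ≡ᵇ r) ≡ false
≢⇒≡ᵇ-false zero    zero    x≢r = ⊥-elim (x≢r refl)
≢⇒≡ᵇ-false zero    (suc r) x≢r = refl
≢⇒≡ᵇ-false (suc x) zero    x≢r = refl
≢⇒≡ᵇ-false (suc x) (suc r) x≢r = ≢⇒≡ᵇ-false x r (x≢r ∘ cong suc)

set-same : ∀ R r v → set R r v r ≡ v
set-same R r v rewrite ≡ᵇ-refl r = refl

set-other : ∀ R r v x → x ≢ r → set R r v x ≡ R x
set-other R r v x x≢r rewrite ≢⇒≡ᵇ-false x r x≢r = refl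

_∉ᵇ_ : ℕ → List ℕ → Bool
x ∉ᵇ []       = true
x ∉ᵇ (r ∷ rs) = if x ≡ᵇ r then false else x ∉ᵇ rs

∉ᵇ-head : ∀ {x r rs} → T (x ∉ᵇ (r ∷ rs)) → x ≢ r
∉ᵇ-head {x} h refl rewrite ≡ᵇ-refl x = h

∉ᵇ-tail : ∀ {x r rs} → T (x ∉ᵇ (r ∷ rs)) → T (x ∉ᵇ rs)
∉ᵇ-tail {x} {r} h with x ≡ᵇ r
... | false = h

∉ᵇ-∷ : ∀ {x r rs} → x ≢ r → T (x ∉ᵇ rs) → T (x ∉ᵇ (r ∷ rs))
∉ᵇ-∷ {x} {r} x≢r h rewrite ≢⇒≡ᵇ-false x r x≢r = h

record _∈ʳ_ (r : ℕ) (ms : List ℕ) : Set where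
  constructor mk∈ʳ
  field ∉⇒≢ : ∀ x → T (x ∉ᵇ ms) → x ≢ r
open _∈ʳ_ public

record _⊆ʳ_ (ms₁ ms : List ℕ) : Set where
  constructor mk⊆ʳ
  field ∉-anti : ∀ x → T (x ∉ᵇ ms) → T (x ∉ᵇ ms₁)
open _⊆ʳ_ public

∈ʳ-here : ∀ {r ms} → r ∈ʳ (r ∷ ms)
∈ʳ-here {r} {ms} = mk∈ʳ λ x → ∉ᵇ-head {x} {r} {ms}

∈ʳ-there : ∀ {r s ms} → r ∈ʳ ms → r ∈ʳ (s ∷ ms)
∈ʳ-there {s = s} {ms} r∈ = mk∈ʳ λ x h → ∉⇒≢ r∈ x (∉ᵇ-tail {x} {s} {ms} h)

⊆ʳ-[] : ∀ {ms} → [] ⊆ʳ ms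
⊆ʳ-[] = mk⊆ʳ λ x h → tt

⊆ʳ-∷ : ∀ {r rs ms} → r ∈ʳ ms → rs ⊆ʳ ms → (r ∷ rs) ⊆ʳ ms
⊆ʳ-∷ {r} {rs} r∈ rs⊆ = mk⊆ʳ λ x h → ∉ᵇ-∷ {x} {r} {rs} (∉⇒≢ r∈ x h) (∉-anti rs⊆ x h)

⊆ʳ-singleton : ∀ {r ms} → r ∈ʳ ms → (r ∷ []) ⊆ʳ ms
⊆ʳ-singleton r∈ = ⊆ʳ-∷ r∈ ⊆ʳ-[]

_∈ᵇ_ : ℕ → List ℕ → Bool
r ∈ᵇ []       = false
r ∈ᵇ (m ∷ ms) = (r ≡ᵇ m) ∨ (r ∈ᵇ ms)

∈ᵇ⇒∈ʳ : ∀ r ms → T (r ∈ᵇ ms) → r ∈ʳ ms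
∈ᵇ⇒∈ʳ r (m ∷ ms) h with Equivalence.to T-∨ h
... | inj₁ r≡m rewrite ≡ᵇ⇒≡ r m r≡m = ∈ʳ-here
... | inj₂ r∈ms = ∈ʳ-there (∈ᵇ⇒∈ʳ r ms r∈ms)

_⊆ᵇ_ : List ℕ → List ℕ → Bool
[]       ⊆ᵇ ms = true
(r ∷ rs) ⊆ᵇ ms = (r ∈ᵇ ms) ∧ (rs ⊆ᵇ ms)

⊆ᵇ⇒⊆ʳ : ∀ rs ms → T (rs ⊆ᵇ ms) → rs ⊆ʳ ms
⊆ᵇ⇒⊆ʳ []       ms h = ⊆ʳ-[]
⊆ᵇ⇒⊆ʳ (r ∷ rs) ms h with Equivalence.to T-∧ h
... | r∈ms , rs⊆ms = ⊆ʳ-∷ (∈ᵇ⇒∈ʳ r ms r∈ms) (⊆ᵇ⇒⊆ʳ rs ms rs⊆ms)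

record Modifies (ms : List ℕ) (R R′ : Regs) : Set where
  constructor mkModifies
  field unmodified : ∀ x → T (x ∉ᵇ ms) → R′ x ≡ R x
open Modifies public

modifies-refl : ∀ {ms R} → Modifies ms R R
modifies-refl = mkModifies λ x h → refl

modifies-trans : ∀ {ms R R₁ R₂} → Modifies ms R R₁ → Modifies ms R₁ R₂ → Modifies ms R R₂
modifies-trans m₁ m₂ = mkModifies λ x h → trans (unmodified m₂ x h) (unmodified m₁ x h)

modifies-⊆ : ∀ {ms₁ ms R R′} → ms₁ ⊆ʳ ms → Modifies ms₁ R R′ → Modifies ms R R′
modifies-⊆ ms₁⊆ms m = mkModifies λ x h → unmodified m x (∉-anti ms₁⊆ms x h)

modifies-⊆ᵇ : ∀ {ms₁ ms R R′} → T (ms₁ ⊆ᵇ ms) → Modifies ms₁ R R′ → Modifies ms R R′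
modifies-⊆ᵇ {ms₁} {ms} h = modifies-⊆ (⊆ᵇ⇒⊆ʳ ms₁ ms h)

modifies-set : ∀ {ms R r v} → r ∈ʳ ms → Modifies ms R (set R r v)
modifies-set {R = R} {r} {v} r∈ = mkModifies λ x h → set-other R r v x (∉⇒≢ r∈ x h)

modifies-restore : ∀ {a ms R R′} → Modifies (a ∷ ms) R R′ → R′ a ≡ R a → Modifies ms R R′
modifies-restore {a} {ms} {R} {R′} m restored = mkModifies go
  where
  go : ∀ x → T (x ∉ᵇ ms) → R′ x ≡ R x
  go x h with x ≡ᵇ a in x≡ᵇa
  ... | true rewrite ≡ᵇ⇒≡ x a (subst T (sym x≡ᵇa) tt) = restored
  ... | false = unmodified m x (subst (λ b → T (if b then false else x ∉ᵇ ms)) (sym x≡ᵇa) h)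

∉ᵇ-++ : ∀ x ms₁ {ms₂} → T (x ∉ᵇ (ms₁ ++ ms₂)) → T (x ∉ᵇ ms₁) × T (x ∉ᵇ ms₂)
∉ᵇ-++ x []        h = tt , h
∉ᵇ-++ x (r ∷ ms₁) h with x ≡ᵇ r
... | false = ∉ᵇ-++ x ms₁ h

_⨾_ : ∀ {ms₁ ms₂ R R₁ R₂} → Modifies ms₁ R R₁ → Modifies ms₂ R₁ R₂ → Modifies (ms₁ ++ ms₂) R R₂
_⨾_ {ms₁} m₁ m₂ = mkModifies λ x h →
  let (h₁ , h₂) = ∉ᵇ-++ x ms₁ h in trans (unmodified m₂ x h₂) (unmodified m₁ x h₁)
infixr 5 _⨾_

unmodified₁ : ∀ {a R R′ x} → Modifies (a ∷ []) R R′ → x ≢ a → R′ x ≡ R x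
unmodified₁ {a} {x = x} m x≢a = unmodified m x (∉ᵇ-∷ {x} {a} {[]} x≢a tt)

unmodified₂ : ∀ {a b R R′ x} → Modifies (a ∷ b ∷ []) R R′ → x ≢ a → x ≢ b → R′ x ≡ R x
unmodified₂ {a} {b} {x = x} m x≢a x≢b = unmodified m x (∉ᵇ-∷ {x} {a} {b ∷ []} x≢a (∉ᵇ-∷ {x} {b} {[]} x≢b tt))

unmodified₃ : ∀ {a b c R R′ x} → Modifies (a ∷ b ∷ c ∷ []) R R′ → x ≢ a → x ≢ b → x ≢ c → R′ x ≡ R x
unmodified₃ {a} {b} {c} {x = x} m x≢a x≢b x≢c =
  unmodified m x (∉ᵇ-∷ {x} {a} {b ∷ c ∷ []} x≢a (∉ᵇ-∷ {x} {b} {c ∷ []} x≢b (∉ᵇ-∷ {x} {c} {[]} x≢c tt)))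

distinct? : ∀ rs → Dec (AllPairs _≢_ rs)
distinct? = allPairs? λ x y → ¬? (x ≟ y)

data Placed (P : Prog) : ℕ → Prog → Set where
  []  : ∀ {o} → Placed P o []
  _∷_ : ∀ {o i B} → lookupI P o ≡ i → Placed P (suc o) B → Placed P o (i ∷ B)

placed-++ : ∀ P o B₁ {B₂} → Placed P o (B₁ ++ B₂) → Placed P o B₁ × Placed P (length B₁ + o) B₂
placed-++ P o []       h = [] , h
placed-++ P o (i ∷ B₁) {B₂} (e ∷ h) with placed-++ P (suc o) B₁ h
... | h₁ , h₂ = (e ∷ h₁) , subst (λ a → Placed P a B₂) (+-suc (length B₁) o) h₂

lookupI-drop : ∀ P o {i rest} → drop o P ≡ i ∷ rest → lookupI P o ≡ i × drop (suc o) P ≡ rest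
lookupI-drop (j ∷ P) zero    refl = refl , refl
lookupI-drop (j ∷ P) (suc o) e    = lookupI-drop P o e

placed : ∀ {P o} B {rest} → drop o P ≡ B ++ rest → Placed P o B
placed         []      e = []
placed {P} {o} (i ∷ B) e with lookupI-drop P o e
... | eᵢ , e′ = eᵢ ∷ placed B e′

-- Unary numerals and registers stored as lists

_∷ᵘ_ : ℕ → BitString → BitString
n ∷ᵘ s = replicate n true ++ false ∷ s
infixr 5 _∷ᵘ_

popUnary : BitString → ℕ × BitString
popUnary []          = 0 , []
popUnary (false ∷ s) = 0 , s
popUnary (true ∷ s)  = suc (proj₁ (popUnary s)) , proj₂ (popUnary s)

popUnary-∷ᵘ : ∀ n s → popUnary (n ∷ᵘ s) ≡ (n , s)
popUnary-∷ᵘ zero    s = refl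
popUnary-∷ᵘ (suc n) s rewrite popUnary-∷ᵘ n s = refl

replicate-true-snoc : ∀ n (s : BitString) → replicate n true ++ true ∷ s ≡ replicate (suc n) true ++ s
replicate-true-snoc zero    s = refl
replicate-true-snoc (suc n) s = cong (true ∷_) (replicate-true-snoc n s)

unaryList : List ℕ → BitString
unaryList []       = []
unaryList (x ∷ xs) = x ∷ᵘ unaryList xs

-- Total list operations reading absent entries as 0, so that a finite list
-- models the infinitely many registers of a machine.

head0 : List ℕ → ℕ
head0 []      = 0
head0 (x ∷ _) = x

tail0 : List ℕ → List ℕ
tail0 []       = []
tail0 (_ ∷ xs) = xs

drop0 : ℕ → List ℕ → List ℕ
drop0 zero    L = L
drop0 (suc k) L = drop0 k (tail0 L)

take0 : ℕ → List ℕ → List ℕ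
take0 zero    L = []
take0 (suc k) L = head0 L ∷ take0 k (tail0 L)

nth0 : List ℕ → ℕ → ℕ
nth0 []       _       = 0
nth0 (x ∷ xs) zero    = x
nth0 (x ∷ xs) (suc i) = nth0 xs i

setNth0 : List ℕ → ℕ → ℕ → List ℕ
setNth0 L r v = take0 r L ++ v ∷ tail0 (drop0 r L)

popUnary-unaryList : ∀ L → popUnary (unaryList L) ≡ (head0 L , unaryList (tail0 L))
popUnary-unaryList []      = refl
popUnary-unaryList (x ∷ L) = popUnary-∷ᵘ x (unaryList L)

nth0-tail0 : ∀ L i → nth0 (tail0 L) i ≡ nth0 L (suc i)
nth0-tail0 []      i = refl
nth0-tail0 (x ∷ L) i = refl

nth0-zero : ∀ L → head0 L ≡ nth0 L 0
nth0-zero []      = refl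
nth0-zero (x ∷ L) = refl

head0-drop0 : ∀ i L → head0 (drop0 i L) ≡ nth0 L i
head0-drop0 zero    L = nth0-zero L
head0-drop0 (suc i) L = trans (head0-drop0 i (tail0 L)) (nth0-tail0 L i)

length-take0 : ∀ k L → length (take0 k L) ≡ k
length-take0 zero    L = refl
length-take0 (suc k) L = cong suc (length-take0 k (tail0 L))

take0-length : ∀ L → take0 (length L) L ≡ L
take0-length []      = refl
take0-length (x ∷ L) = cong (x ∷_) (take0-length L)

take0-ʳ++-take0 : ∀ r L N → take0 r (take0 r L ʳ++ []) ʳ++ N ≡ take0 r L ++ N
take0-ʳ++-take0 r L N = begin
  take0 r (take0 r L ʳ++ []) ʳ++ N                                   ≡⟨ cong (λ k → take0 k Z ʳ++ N) r≡∣Z∣ ⟩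
  take0 (length Z) Z ʳ++ N                                           ≡⟨ cong (_ʳ++ N) (take0-length Z) ⟩
  (take0 r L ʳ++ []) ʳ++ N                                           ≡⟨ ʳ++-ʳ++ (take0 r L) ⟩
  take0 r L ++ N                                                     ∎
  where
  open ≡-Reasoning
  Z = take0 r L ʳ++ []
  r≡∣Z∣ : r ≡ length Z
  r≡∣Z∣ = sym (trans (length-ʳ++ (take0 r L)) (trans (+-identityʳ _) (length-take0 r L)))

nth0-setNth0 : ∀ r L v i → nth0 (setNth0 L r v) i ≡ (if i ≡ᵇ r then v else nth0 L i)
nth0-setNth0 zero    L v zero    = refl
nth0-setNth0 zero    L v (suc i) = nth0-tail0 L i
nth0-setNth0 (suc r) L v zero    = nth0-zero L
nth0-setNth0 (suc r) L v (suc i) =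
  trans (nth0-setNth0 r (tail0 L) v i) (cong (if i ≡ᵇ r then v else_) (nth0-tail0 L i))

-- The least element of Y among m, …, m + d − 1, and m + d if there is none.
firstIn : Subset → ℕ → ℕ → ℕ
firstIn Y zero    m = m
firstIn Y (suc d) m = if Y m then m else firstIn Y d (suc m)

firstIn-∈ : ∀ (Y : Subset) d m → Y (m + d) ≡ true → Y (firstIn Y d m) ≡ true
firstIn-∈ Y zero    m h = trans (cong Y (sym (+-identityʳ m))) h
firstIn-∈ Y (suc d) m h with Y m in e
... | true  = e
... | false = firstIn-∈ Y d (suc m) (trans (cong Y (sym (+-suc m d))) h)

data Parsed : Set where
  end   : BitString → Parsed
  instr : Instr → BitString → Parsed

arg₁ arg₂ arg₃ : BitString → ℕ
rest₁ rest₂ rest₃ : BitString → BitString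
arg₁ t  = proj₁ (popUnary t)
rest₁ t = proj₂ (popUnary t)
arg₂ t  = proj₁ (popUnary (rest₁ t))
rest₂ t = proj₂ (popUnary (rest₁ t))
arg₃ t  = proj₁ (popUnary (rest₂ t))
rest₃ t = proj₂ (popUnary (rest₂ t))

instrWithOpcode : ℕ → BitString → Parsed
instrWithOpcode 0 t = instr (inc (arg₁ t) (arg₂ t)) (rest₂ t)
instrWithOpcode 1 t = instr (decjz (arg₁ t) (arg₂ t) (arg₃ t)) (rest₃ t)
instrWithOpcode 2 t = instr (orc (arg₁ t) (arg₂ t) (arg₃ t)) (rest₃ t)
instrWithOpcode (suc (suc (suc _))) t = instr halt t

-- Unlike `parseProg'`, this never fails: an unterminated numeral is read as if
-- terminated, which is what the interpreter below does.
parseInstr : BitString → Parsed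
parseInstr []          = end []
parseInstr (false ∷ s) = end s
parseInstr (true ∷ s)  = instrWithOpcode (proj₁ (popUnary s)) (proj₂ (popUnary s))

parseNat⇒popUnary : ∀ s {k t} → parseNat s ≡ just (k , t) → popUnary s ≡ (k , t)
parseNat⇒popUnary (false ∷ s) refl = refl
parseNat⇒popUnary (true ∷ s) h with parseNat s in e
... | nothing = case h of λ ()
... | just (k , t) with h
... | refl rewrite parseNat⇒popUnary s e = refl

parseArgs-suc-inv : ∀ a t {as u} → parseArgs (suc a) t ≡ just (as , u) →
  Σ ℕ λ k → Σ BitString λ t′ → Σ (List ℕ) λ as′ →
    parseNat t ≡ just (k , t′) × parseArgs a t′ ≡ just (as′ , u) × as ≡ k ∷ as′
parseArgs-suc-inv a t h with parseNat t in e
... | nothing = case h of λ ()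
... | just (k , t′) with parseArgs a t′ in e′
...   | nothing = case h of λ ()
...   | just (as′ , u) with h
...     | refl = k , t′ , as′ , refl , e′ , refl

parseArgs-zero-inv : ∀ t {as u} → parseArgs 0 t ≡ just (as , u) → as ≡ [] × u ≡ t
parseArgs-zero-inv t refl = refl , refl

parseArgs⇒instrWithOpcode : ∀ op t {as u} → parseArgs (arity op) t ≡ just (as , u) →
  instrWithOpcode op t ≡ instr (mkInstr op as) u
parseArgs⇒instrWithOpcode 0 t h with parseArgs-suc-inv 1 t h
... | _ , t₁ , _ , e₁ , h₁ , refl with parseArgs-suc-inv 0 t₁ h₁
... | _ , t₂ , _ , e₂ , h₂ , refl with parseArgs-zero-inv t₂ h₂
... | refl , refl rewrite parseNat⇒popUnary t e₁ | parseNat⇒popUnary t₁ e₂ = refl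
parseArgs⇒instrWithOpcode 1 t h with parseArgs-suc-inv 2 t h
... | _ , t₁ , _ , e₁ , h₁ , refl with parseArgs-suc-inv 1 t₁ h₁
... | _ , t₂ , _ , e₂ , h₂ , refl with parseArgs-suc-inv 0 t₂ h₂
... | _ , t₃ , _ , e₃ , h₃ , refl with parseArgs-zero-inv t₃ h₃
... | refl , refl rewrite parseNat⇒popUnary t e₁ | parseNat⇒popUnary t₁ e₂ | parseNat⇒popUnary t₂ e₃ = refl
parseArgs⇒instrWithOpcode 2 t h with parseArgs-suc-inv 2 t h
... | _ , t₁ , _ , e₁ , h₁ , refl with parseArgs-suc-inv 1 t₁ h₁
... | _ , t₂ , _ , e₂ , h₂ , refl with parseArgs-suc-inv 0 t₂ h₂
... | _ , t₃ , _ , e₃ , h₃ , refl with parseArgs-zero-inv t₃ h₃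
... | refl , refl rewrite parseNat⇒popUnary t e₁ | parseNat⇒popUnary t₁ e₂ | parseNat⇒popUnary t₂ e₃ = refl
parseArgs⇒instrWithOpcode (suc (suc (suc op))) t h with parseArgs-zero-inv t h
... | refl , refl = refl

ParseProgStep : BitString → Prog → BitString → Set
ParseProgStep s P d =
  (parseInstr s ≡ end d × P ≡ []) ⊎
  (Σ Instr λ i → Σ BitString λ t → Σ Prog λ P′ → Σ ℕ λ f →
     parseInstr s ≡ instr i t × P ≡ i ∷ P′ × parseProg' f t ≡ just (P′ , d))

parseProg'-step : ∀ f s {P d} → parseProg' f s ≡ just (P , d) → ParseProgStep s P d
parseProg'-step (suc f) (false ∷ s) refl = inj₁ (refl , refl)
parseProg'-step (suc f) (true ∷ s) h with parseNat s in e₁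
... | nothing = case h of λ ()
... | just (op , t) with parseArgs (arity op) t in e₂
...   | nothing = case h of λ ()
...   | just (as , u) with parseProg' f u in e₃
...     | nothing = case h of λ ()
...     | just (P′ , v) with h
...       | refl = inj₂ (mkInstr op as , u , P′ , f , parsed , refl , e₃)
  where
  parsed : parseInstr (true ∷ s) ≡ instr (mkInstr op as) u
  parsed rewrite parseNat⇒popUnary s e₁ = parseArgs⇒instrWithOpcode op t e₂

-- Each code block takes its start address first and its exit addresses last.

clearCode : ℕ → ℕ → Prog
clearCode o r = decjz r o (suc o) ∷ []

addCode : ℕ → ℕ → ℕ → ℕ → Prog
addCode o src dst ex = decjz src (suc o) ex ∷ inc dst o ∷ []

add₂Code : ℕ → ℕ → ℕ → ℕ → ℕ → Prog
add₂Code o src d₁ d₂ ex = decjz src (suc o) ex ∷ inc d₁ (2 + o) ∷ inc d₂ o ∷ []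

halveCode : ℕ → ℕ → ℕ → ℕ → ℕ → Prog
halveCode o x q exEven exOdd = decjz x (suc o) exEven ∷ decjz x (2 + o) exOdd ∷ inc q o ∷ []

doubleCode : ℕ → ℕ → ℕ → ℕ → Prog
doubleCode o x dst ex = decjz x (suc o) ex ∷ inc dst (2 + o) ∷ inc dst o ∷ []

copyCode : ℕ → ℕ → ℕ → ℕ → ℕ → Prog
copyCode o src dst tmp ex =
  clearCode o dst ++ clearCode (1 + o) tmp ++ add₂Code (2 + o) src dst tmp (5 + o) ++ addCode (5 + o) tmp src ex

readBitCode : ℕ → ℕ → ℕ → ℕ → ℕ → ℕ → Prog
readBitCode o S H exEmpty ex₀ ex₁ =
  decjz S (1 + o) exEmpty ∷
  (clearCode (1 + o) H ++ halveCode (2 + o) S H (5 + o) (7 + o) ++ addCode (5 + o) H S ex₀ ++ addCode (7 + o) H S ex₁)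

readBitExit : ℕ → ℕ → ℕ → BitString → ℕ
readBitExit exEmpty ex₀ ex₁ []          = exEmpty
readBitExit exEmpty ex₀ ex₁ (false ∷ _) = ex₀
readBitExit exEmpty ex₀ ex₁ (true ∷ _)  = ex₁

addSucBitCode : ℕ → ℕ → Bool → ℕ → Prog
addSucBitCode o S false ex = inc S ex ∷ []
addSucBitCode o S true  ex = inc S (7 + o) ∷ inc S ex ∷ []

pushBitCode : ℕ → ℕ → ℕ → Bool → ℕ → Prog
pushBitCode o S H b ex =
  clearCode o H ++ doubleCode (1 + o) S H (4 + o) ++ addCode (4 + o) H S (6 + o) ++ addSucBitCode o S b ex

popUnaryCode : ℕ → ℕ → ℕ → ℕ → ℕ → Prog
popUnaryCode o S V H ex = clearCode o V ++ readBitCode (1 + o) S H ex ex (10 + o) ++ (inc V (1 + o) ∷ [])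

pushUnaryCode : ℕ → ℕ → ℕ → ℕ → ℕ → Prog
pushUnaryCode o V S H ex =
  pushBitCode o S H false (7 + o) ++ (decjz V (8 + o) ex ∷ pushBitCode (8 + o) S H true (7 + o))

searchCode : ℕ → ℕ → ℕ → Prog
searchCode o V ex = orc V ex (1 + o) ∷ inc V o ∷ []

transferCode : ℕ → ℕ → ℕ → ℕ → ℕ → ℕ → ℕ → Prog
transferCode o A B K U H ex =
  decjz K (1 + o) ex ∷ (popUnaryCode (1 + o) A U H (12 + o) ++ pushUnaryCode (12 + o) U B H o)

lookupCode : ℕ → ℕ → Prog
lookupCode o ex =
  copyCode o 2 14 19 (7 + o) ++ clearCode (7 + o) 15 ++ transferCode (8 + o) 14 15 13 17 11 (36 + o) ++
  popUnaryCode (36 + o) 14 12 11 ex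

storeCode : ℕ → ℕ → Prog
storeCode o ex =
  copyCode o 13 18 19 (7 + o) ++ clearCode (7 + o) 16 ++ transferCode (8 + o) 2 16 13 17 11 (36 + o) ++
  popUnaryCode (36 + o) 2 17 11 (47 + o) ++ pushUnaryCode (47 + o) 12 2 11 (63 + o) ++
  transferCode (63 + o) 16 2 18 17 11 ex

decodeArgsCode : ℕ → ℕ → Prog
decodeArgsCode o ex =
  popUnaryCode o 5 8 11 (11 + o) ++ popUnaryCode (11 + o) 5 9 11 (22 + o) ++ popUnaryCode (22 + o) 5 10 11 ex

dispatchCode : ℕ → ℕ → Prog
dispatchCode o exHalt = decjz 20 (28 + o) (30 + o) ∷ decjz 20 (29 + o) (52 + o) ∷ decjz 20 exHalt (52 + o) ∷ []

parseInstrCode : ℕ → ℕ → ℕ → ℕ → ℕ → ℕ → Prog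
parseInstrCode o exEnd exInc exDecjz exOrc exHalt =
  readBitCode o 5 11 exEnd exEnd (9 + o) ++
  popUnaryCode (9 + o) 5 7 11 (20 + o) ++
  copyCode (20 + o) 7 20 19 (27 + o) ++
  dispatchCode o exHalt ++
  popUnaryCode (30 + o) 5 8 11 (41 + o) ++
  popUnaryCode (41 + o) 5 9 11 exInc ++
  decodeArgsCode (52 + o) (85 + o) ++
  copyCode (85 + o) 7 20 19 (92 + o) ++
  (decjz 20 (93 + o) exHalt ∷ decjz 20 exOrc exDecjz ∷ [])

exitFor : ℕ → ℕ → ℕ → ℕ → ℕ → Parsed → ℕ
exitFor exEnd exInc exDecjz exOrc exHalt (end _)                  = exEnd
exitFor exEnd exInc exDecjz exOrc exHalt (instr (inc _ _) _)     = exInc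
exitFor exEnd exInc exDecjz exOrc exHalt (instr (decjz _ _ _) _) = exDecjz
exitFor exEnd exInc exDecjz exOrc exHalt (instr (orc _ _ _) _)   = exOrc
exitFor exEnd exInc exDecjz exOrc exHalt (instr halt _)          = exHalt

ParsedInRegs : Parsed → Regs → Set
ParsedInRegs (end t)                   R = R 5 ≡ toℕ t
ParsedInRegs (instr (inc r j) t)       R = R 5 ≡ toℕ t × R 8 ≡ r × R 9 ≡ j
ParsedInRegs (instr (decjz r j k) t)   R = R 5 ≡ toℕ t × R 8 ≡ r × R 9 ≡ j × R 10 ≡ k
ParsedInRegs (instr (orc r j k) t)     R = R 5 ≡ toℕ t × R 8 ≡ r × R 9 ≡ j × R 10 ≡ k
ParsedInRegs (instr halt t)            R = R 5 ≡ toℕ t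

+-2*-suc : ∀ a t → a + 2 * suc t ≡ suc (suc (a + 2 * t))
+-2*-suc = solve-∀

+-suc-suc : ∀ a n → suc (suc a) + (n + n) ≡ a + (suc n + suc n)
+-suc-suc = solve-∀

-- Reasoning about runs

module Execution (Y : Subset) (P : Prog) where

  Halts : Regs → ℕ → ℕ → Set
  Halts R pc v = ∃ λ f → Σ Regs λ S → run Y P f R pc ≡ just S × S 0 ≡ v

  Steps : Regs → ℕ → Regs → ℕ → Set
  Steps R pc R′ pc′ = ∀ v → Halts R′ pc′ v → Halts R pc v

  Reaches : Regs → ℕ → ℕ → (Regs → Set) → Set
  Reaches R pc pc′ Q = Σ Regs λ R′ → Q R′ × Steps R pc R′ pc′

  _⟫_ : ∀ {R a R₁ b R₂ c} → Steps R a R₁ b → Steps R₁ b R₂ c → Steps R a R₂ c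
  (s₁ ⟫ s₂) v h = s₁ v (s₂ v h)
  infixr 5 _⟫_

  _▷_ : ∀ {R a b c Q₁ Q₂} → Reaches R a b Q₁ → (∀ R₁ → Q₁ R₁ → Reaches R₁ b c Q₂) → Reaches R a c Q₂
  (R₁ , q₁ , s₁) ▷ k with k R₁ q₁
  ... | R₂ , q₂ , s₂ = R₂ , q₂ , s₁ ⟫ s₂
  infixr 1 _▷_

  reaches-map : ∀ {R a b} {Q Q′ : Regs → Set} → (∀ R′ → Q R′ → Q′ R′) → Reaches R a b Q → Reaches R a b Q′
  reaches-map g (R′ , q , s) = R′ , g R′ q , s

  steps-reaches : ∀ {R a R₁ b c Q} → Steps R a R₁ b → Reaches R₁ b c Q → Reaches R a c Q
  steps-reaches s (R′ , q , s′) = R′ , q , s ⟫ s′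

  reaches-halts : ∀ {R a b v Q} → Reaches R a b Q → (∀ R′ → Q R′ → Halts R′ b v) → Halts R a v
  reaches-halts (R′ , q , s) k = s _ (k R′ q)

  inc-steps : ∀ {R pc r j} → lookupI P pc ≡ inc r j → Steps R pc (set R r (suc (R r))) j
  inc-steps {R} {pc} {r} {j} e v (f , S , h , S₀) = suc f , S , trans run-inc h , S₀
    where run-inc : run Y P (suc f) R pc ≡ run Y P f (set R r (suc (R r))) j
          run-inc rewrite e = refl

  decjz-zero-steps : ∀ {R pc r j k} → lookupI P pc ≡ decjz r j k → R r ≡ 0 → Steps R pc R k
  decjz-zero-steps {R} {pc} {r} {j} {k} e z v (f , S , h , S₀) = suc f , S , trans run-dz h , S₀
    where run-dz : run Y P (suc f) R pc ≡ run Y P f R k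
          run-dz rewrite e | z = refl

  decjz-suc-steps : ∀ {R pc r j k w} → lookupI P pc ≡ decjz r j k → R r ≡ suc w → Steps R pc (set R r w) j
  decjz-suc-steps {R} {pc} {r} {j} {k} {w} e z v (f , S , h , S₀) = suc f , S , trans run-ds h , S₀
    where run-ds : run Y P (suc f) R pc ≡ run Y P f (set R r w) j
          run-ds rewrite e | z = refl

  orc-true-steps : ∀ {R pc r j k} → lookupI P pc ≡ orc r j k → Y (R r) ≡ true → Steps R pc R j
  orc-true-steps {R} {pc} {r} {j} {k} e y v (f , S , h , S₀) = suc f , S , trans run-ot h , S₀
    where run-ot : run Y P (suc f) R pc ≡ run Y P f R j
          run-ot rewrite e | y = refl

  orc-false-steps : ∀ {R pc r j k} → lookupI P pc ≡ orc r j k → Y (R r) ≡ false → Steps R pc R k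
  orc-false-steps {R} {pc} {r} {j} {k} e y v (f , S , h , S₀) = suc f , S , trans run-of h , S₀
    where run-of : run Y P (suc f) R pc ≡ run Y P f R k
          run-of rewrite e | y = refl

  halt-halts : ∀ {R pc} → lookupI P pc ≡ halt → Halts R pc (R 0)
  halt-halts {R} {pc} e = 1 , R , run-halt , refl
    where run-halt : run Y P 1 R pc ≡ just R
          run-halt rewrite e = refl

  inc-spec : ∀ {R pc r j} → lookupI P pc ≡ inc r j →
    Reaches R pc j (λ R′ → R′ r ≡ suc (R r) × Modifies (r ∷ []) R R′)
  inc-spec {R} {r = r} e = _ , (set-same R r _ , modifies-set ∈ʳ-here) , inc-steps e

  decjz-suc-spec : ∀ {R pc r j k w} → lookupI P pc ≡ decjz r j k → R r ≡ suc w →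
    Reaches R pc j (λ R′ → R′ r ≡ w × Modifies (r ∷ []) R R′)
  decjz-suc-spec {R} {r = r} e h = _ , (set-same R r _ , modifies-set ∈ʳ-here) , decjz-suc-steps e h

  decjz-zero-spec : ∀ {R pc r j k} {Q : Regs → Set} → lookupI P pc ≡ decjz r j k → R r ≡ 0 → Q R →
    Reaches R pc k Q
  decjz-zero-spec e h q = _ , q , decjz-zero-steps e h

  clear-spec : ∀ {o r} → Placed P o (clearCode o r) → ∀ R →
    Reaches R o (suc o) (λ R′ → R′ r ≡ 0 × Modifies (r ∷ []) R R′)
  clear-spec {o} {r} (e ∷ _) R = loop (R r) R refl
    where
    loop : ∀ n R → R r ≡ n → Reaches R o (suc o) (λ R′ → R′ r ≡ 0 × Modifies (r ∷ []) R R′)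
    loop zero    R h = decjz-zero-spec e h (h , modifies-refl)
    loop (suc n) R h =
      decjz-suc-spec e h ▷ λ R₁ (a₁ , m₁) →
      reaches-map (λ R₂ (z , m₂) → z , modifies-trans m₁ m₂) (loop n R₁ a₁)

  add-spec : ∀ {o src dst ex} → Placed P o (addCode o src dst ex) → src ≢ dst → ∀ R →
    Reaches R o ex (λ R′ → R′ src ≡ 0 × R′ dst ≡ R dst + R src × Modifies (src ∷ dst ∷ []) R R′)
  add-spec {o} {src} {dst} {ex} (e₀ ∷ e₁ ∷ _) src≢dst R = loop (R src) R refl
    where
    loop : ∀ n R → R src ≡ n →
      Reaches R o ex (λ R′ → R′ src ≡ 0 × R′ dst ≡ R dst + n × Modifies (src ∷ dst ∷ []) R R′)
    loop zero    R h = decjz-zero-spec e₀ h (h , sym (+-identityʳ (R dst)) , modifies-refl)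
    loop (suc n) R h =
      decjz-suc-spec e₀ h ▷ λ R₁ (a₁ , m₁) →
      inc-spec e₁ ▷ λ R₂ (a₂ , m₂) →
      reaches-map (λ R₃ (z , d , m₃) →
          z ,
          trans d (trans (cong (_+ n) (trans a₂ (cong suc (unmodified₁ m₁ (≢-sym src≢dst))))) (sym (+-suc (R dst) n))) ,
          modifies-trans (modifies-⊆ (⊆ʳ-singleton ∈ʳ-here) m₁)
            (modifies-trans (modifies-⊆ (⊆ʳ-singleton (∈ʳ-there ∈ʳ-here)) m₂) m₃))
        (loop n R₂ (trans (unmodified₁ m₂ src≢dst) a₁))

  halve-spec : ∀ {o x q exEven exOdd} → Placed P o (halveCode o x q exEven exOdd) → x ≢ q →
    ∀ b t R → R x ≡ bit b + 2 * t →
    Reaches R o (if b then exOdd else exEven) (λ R′ → R′ x ≡ 0 × R′ q ≡ R q + t × Modifies (x ∷ q ∷ []) R R′)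
  halve-spec {o} {x} {q} (e₀ ∷ e₁ ∷ e₂ ∷ _) x≢q = loop
    where
    loop : ∀ b t R → R x ≡ bit b + 2 * t →
      Reaches R o (if b then _ else _) (λ R′ → R′ x ≡ 0 × R′ q ≡ R q + t × Modifies (x ∷ q ∷ []) R R′)
    loop false zero R h = decjz-zero-spec e₀ h (h , sym (+-identityʳ (R q)) , modifies-refl)
    loop true  zero R h =
      decjz-suc-spec e₀ h ▷ λ R₁ (a₁ , m₁) →
      decjz-zero-spec e₁ a₁
        (a₁ , trans (unmodified₁ m₁ (≢-sym x≢q)) (sym (+-identityʳ (R q))) , modifies-⊆ (⊆ʳ-singleton ∈ʳ-here) m₁)
    loop b (suc t) R h =
      decjz-suc-spec e₀ (trans h (+-2*-suc (bit b) t)) ▷ λ R₁ (a₁ , m₁) →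
      decjz-suc-spec e₁ a₁ ▷ λ R₂ (a₂ , m₂) →
      inc-spec e₂ ▷ λ R₃ (a₃ , m₃) →
      reaches-map (λ R₄ (z , d , m₄) →
          z ,
          trans d (trans (cong (_+ t) (trans a₃ (cong suc (trans (unmodified₁ m₂ (≢-sym x≢q))
                                                             (unmodified₁ m₁ (≢-sym x≢q))))))
                         (sym (+-suc (R q) t))) ,
          modifies-trans (modifies-⊆ (⊆ʳ-singleton ∈ʳ-here) m₁)
            (modifies-trans (modifies-⊆ (⊆ʳ-singleton ∈ʳ-here) m₂)
              (modifies-trans (modifies-⊆ (⊆ʳ-singleton (∈ʳ-there ∈ʳ-here)) m₃) m₄)))
        (loop b t R₃ (trans (unmodified₁ m₃ x≢q) a₂))

  double-spec : ∀ {o x dst ex} → Placed P o (doubleCode o x dst ex) → x ≢ dst → ∀ R →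
    Reaches R o ex (λ R′ → R′ x ≡ 0 × R′ dst ≡ R dst + (R x + R x) × Modifies (x ∷ dst ∷ []) R R′)
  double-spec {o} {x} {dst} {ex} (e₀ ∷ e₁ ∷ e₂ ∷ _) x≢dst R = loop (R x) R refl
    where
    loop : ∀ n R → R x ≡ n →
      Reaches R o ex (λ R′ → R′ x ≡ 0 × R′ dst ≡ R dst + (n + n) × Modifies (x ∷ dst ∷ []) R R′)
    loop zero    R h = decjz-zero-spec e₀ h (h , sym (+-identityʳ (R dst)) , modifies-refl)
    loop (suc n) R h =
      decjz-suc-spec e₀ h ▷ λ R₁ (a₁ , m₁) →
      inc-spec e₁ ▷ λ R₂ (a₂ , m₂) →
      inc-spec e₂ ▷ λ R₃ (a₃ , m₃) →
      reaches-map (λ R′ (z , d , m) →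
          z ,
          trans d (trans (cong (_+ (n + n)) (trans a₃ (cong suc (trans a₂ (cong suc (unmodified₁ m₁ (≢-sym x≢dst)))))))
                         (+-suc-suc (R dst) n)) ,
          modifies-trans (modifies-⊆ (⊆ʳ-singleton ∈ʳ-here) m₁)
            (modifies-trans (modifies-⊆ (⊆ʳ-singleton (∈ʳ-there ∈ʳ-here)) m₂)
              (modifies-trans (modifies-⊆ (⊆ʳ-singleton (∈ʳ-there ∈ʳ-here)) m₃) m)))
        (loop n R₃ (trans (unmodified₁ m₃ x≢dst) (trans (unmodified₁ m₂ x≢dst) a₁)))

  add₂-spec : ∀ {o src d₁ d₂ ex} → Placed P o (add₂Code o src d₁ d₂ ex) → src ≢ d₁ → src ≢ d₂ → d₁ ≢ d₂ → ∀ R →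
    Reaches R o ex (λ R′ → R′ src ≡ 0 × R′ d₁ ≡ R d₁ + R src × R′ d₂ ≡ R d₂ + R src ×
                          Modifies (src ∷ d₁ ∷ d₂ ∷ []) R R′)
  add₂-spec {o} {src} {d₁} {d₂} {ex} (e₀ ∷ e₁ ∷ e₂ ∷ _) src≢d₁ src≢d₂ d₁≢d₂ R = loop (R src) R refl
    where
    loop : ∀ n R → R src ≡ n →
      Reaches R o ex (λ R′ → R′ src ≡ 0 × R′ d₁ ≡ R d₁ + n × R′ d₂ ≡ R d₂ + n × Modifies (src ∷ d₁ ∷ d₂ ∷ []) R R′)
    loop zero    R h =
      decjz-zero-spec e₀ h (h , sym (+-identityʳ (R d₁)) , sym (+-identityʳ (R d₂)) , modifies-refl)
    loop (suc n) R h =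
      decjz-suc-spec e₀ h ▷ λ R₁ (a₁ , m₁) →
      inc-spec e₁ ▷ λ R₂ (a₂ , m₂) →
      inc-spec e₂ ▷ λ R₃ (a₃ , m₃) →
      reaches-map (λ R′ (z , b₁ , b₂ , m) →
          z ,
          trans b₁ (trans (cong (_+ n) (trans (unmodified₁ m₃ d₁≢d₂) (trans a₂ (cong suc (unmodified₁ m₁ (≢-sym src≢d₁))))))
                          (sym (+-suc (R d₁) n))) ,
          trans b₂ (trans (cong (_+ n) (trans a₃ (cong suc (trans (unmodified₁ m₂ (≢-sym d₁≢d₂))
                                                              (unmodified₁ m₁ (≢-sym src≢d₂))))))
                          (sym (+-suc (R d₂) n))) ,
          modifies-trans (modifies-⊆ (⊆ʳ-singleton ∈ʳ-here) m₁)
            (modifies-trans (modifies-⊆ (⊆ʳ-singleton (∈ʳ-there ∈ʳ-here)) m₂)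
              (modifies-trans (modifies-⊆ (⊆ʳ-singleton (∈ʳ-there (∈ʳ-there ∈ʳ-here))) m₃) m)))
        (loop n R₃ (trans (unmodified₁ m₃ src≢d₂) (trans (unmodified₁ m₂ src≢d₁) a₁)))

  copy-spec : ∀ {o src dst tmp ex} → Placed P o (copyCode o src dst tmp ex) →
    src ≢ dst → src ≢ tmp → dst ≢ tmp → ∀ R →
    Reaches R o ex (λ R′ → R′ dst ≡ R src × R′ src ≡ R src × R′ tmp ≡ 0 × Modifies (src ∷ dst ∷ tmp ∷ []) R R′)
  copy-spec {o} {src} {dst} {tmp} {ex} pl src≢dst src≢tmp dst≢tmp R
    with placed-++ P o (clearCode o dst) pl
  ... | p₁ , pl₁ with placed-++ P (1 + o) (clearCode (1 + o) tmp) pl₁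
  ... | p₂ , pl₂ with placed-++ P (2 + o) (add₂Code (2 + o) src dst tmp (5 + o)) pl₂
  ... | p₃ , p₄ =
    clear-spec p₁ R ▷ λ R₁ (a₁ , m₁) →
    clear-spec p₂ R₁ ▷ λ R₂ (a₂ , m₂) →
    add₂-spec p₃ src≢dst src≢tmp dst≢tmp R₂ ▷ λ R₃ (b₀ , b₁ , b₂ , m₃) →
    reaches-map (λ R₄ (c₀ , c₁ , m₄) →
        trans (unmodified₂ m₄ dst≢tmp (≢-sym src≢dst))
          (trans b₁ (cong₂ _+_ (trans (unmodified₁ m₂ dst≢tmp) a₁) (src-kept R₂ m₁ m₂))) ,
        trans c₁ (cong₂ _+_ b₀ (trans b₂ (cong₂ _+_ a₂ (src-kept R₂ m₁ m₂)))) ,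
        c₀ ,
        modifies-trans (modifies-⊆ (⊆ʳ-singleton (∈ʳ-there ∈ʳ-here)) m₁)
          (modifies-trans (modifies-⊆ (⊆ʳ-singleton (∈ʳ-there (∈ʳ-there ∈ʳ-here))) m₂)
            (modifies-trans m₃ (modifies-⊆ (⊆ʳ-∷ (∈ʳ-there (∈ʳ-there ∈ʳ-here)) (⊆ʳ-singleton ∈ʳ-here)) m₄))))
      (add-spec p₄ (≢-sym src≢tmp) R₃)
    where
    src-kept : ∀ R₂ {R₁} → Modifies (dst ∷ []) R R₁ → Modifies (tmp ∷ []) R₁ R₂ → R₂ src ≡ R src
    src-kept R₂ m₁ m₂ = trans (unmodified₁ m₂ src≢tmp) (unmodified₁ m₁ src≢dst)

  readBit-spec : ∀ {o S H exEmpty ex₀ ex₁} → Placed P o (readBitCode o S H exEmpty ex₀ ex₁) → S ≢ H →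
    ∀ s R → R S ≡ toℕ s →
    Reaches R o (readBitExit exEmpty ex₀ ex₁ s) (λ R′ → R′ S ≡ toℕ (drop 1 s) × Modifies (S ∷ H ∷ []) R R′)
  readBit-spec (e₀ ∷ _) S≢H [] R h = decjz-zero-spec e₀ h (h , modifies-refl)
  readBit-spec {o} {S} {H} {exEmpty} {ex₀} {ex₁} (e₀ ∷ pl) S≢H (b ∷ t) R h
    with placed-++ P (1 + o) (clearCode (1 + o) H) pl
  ... | p₁ , pl₁ with placed-++ P (2 + o) (halveCode (2 + o) S H (5 + o) (7 + o)) pl₁
  ... | p₂ , pl₂ with placed-++ P (5 + o) (addCode (5 + o) H S ex₀) pl₂
  ... | p₃ , p₄ =
    decjz-suc-spec e₀ h ▷ λ R₁ (a₁ , m₁) →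
    clear-spec p₁ R₁ ▷ λ R₂ (a₂ , m₂) →
    halve-spec p₂ S≢H b (toℕ t) R₂ (trans (unmodified₁ m₂ S≢H) a₁) ▷ λ R₃ (b₀ , b₁ , m₃) →
    restore b R₃ b₀ (trans b₁ (cong (_+ toℕ t) a₂))
      (modifies-trans (modifies-⊆ (⊆ʳ-singleton ∈ʳ-here) m₁)
        (modifies-trans (modifies-⊆ (⊆ʳ-singleton (∈ʳ-there ∈ʳ-here)) m₂) m₃))
    where
    restore : ∀ b R₃ → R₃ S ≡ 0 → R₃ H ≡ toℕ t → Modifies (S ∷ H ∷ []) R R₃ →
      Reaches R₃ (if b then 7 + o else 5 + o) (readBitExit exEmpty ex₀ ex₁ (b ∷ t))
        (λ R′ → R′ S ≡ toℕ t × Modifies (S ∷ H ∷ []) R R′)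
    restore false R₃ b₀ b₁ m =
      reaches-map (λ R₄ (_ , c₁ , m₄) →
          trans c₁ (cong₂ _+_ b₀ b₁) , modifies-trans m (modifies-⊆ (⊆ʳ-∷ (∈ʳ-there ∈ʳ-here) (⊆ʳ-singleton ∈ʳ-here)) m₄))
        (add-spec p₃ (≢-sym S≢H) R₃)
    restore true R₃ b₀ b₁ m =
      reaches-map (λ R₄ (_ , c₁ , m₄) →
          trans c₁ (cong₂ _+_ b₀ b₁) , modifies-trans m (modifies-⊆ (⊆ʳ-∷ (∈ʳ-there ∈ʳ-here) (⊆ʳ-singleton ∈ʳ-here)) m₄))
        (add-spec p₄ (≢-sym S≢H) R₃)

  pushBit-spec : ∀ {o S H ex} b → Placed P o (pushBitCode o S H b ex) → S ≢ H → ∀ s R → R S ≡ toℕ s →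
    Reaches R o ex (λ R′ → R′ S ≡ toℕ (b ∷ s) × Modifies (S ∷ H ∷ []) R R′)
  pushBit-spec {o} {S} {H} {ex} b pl S≢H s R h
    with placed-++ P o (clearCode o H) pl
  ... | p₁ , pl₁ with placed-++ P (1 + o) (doubleCode (1 + o) S H (4 + o)) pl₁
  ... | p₂ , pl₂ with placed-++ P (4 + o) (addCode (4 + o) H S (6 + o)) pl₂
  ... | p₃ , p₄ =
    clear-spec p₁ R ▷ λ R₁ (a₁ , m₁) →
    double-spec p₂ S≢H R₁ ▷ λ R₂ (b₀ , b₁ , m₂) →
    add-spec p₃ (≢-sym S≢H) R₂ ▷ λ R₃ (c₀ , c₁ , m₃) →
    addSucBit b p₄ R₃
      (trans c₁ (trans (cong₂ _+_ b₀ (trans b₁ (cong₂ _+_ a₁ (cong₂ _+_ (s-kept m₁) (s-kept m₁)))))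
                       (cong (toℕ s +_) (sym (+-identityʳ (toℕ s))))))
      (modifies-trans (modifies-⊆ (⊆ʳ-singleton (∈ʳ-there ∈ʳ-here)) m₁)
        (modifies-trans m₂ (modifies-⊆ (⊆ʳ-∷ (∈ʳ-there ∈ʳ-here) (⊆ʳ-singleton ∈ʳ-here)) m₃)))
    where
    s-kept : ∀ {R₁} → Modifies (H ∷ []) R R₁ → R₁ S ≡ toℕ s
    s-kept m₁ = trans (unmodified₁ m₁ S≢H) h
    addSucBit : ∀ b → Placed P (6 + o) (addSucBitCode o S b ex) → ∀ R₃ → R₃ S ≡ 2 * toℕ s →
      Modifies (S ∷ H ∷ []) R R₃ → Reaches R₃ (6 + o) ex (λ R′ → R′ S ≡ toℕ (b ∷ s) × Modifies (S ∷ H ∷ []) R R′)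
    addSucBit false (e ∷ _) R₃ v m =
      reaches-map (λ R₄ (d , m₄) → trans d (cong suc v) , modifies-trans m (modifies-⊆ (⊆ʳ-singleton ∈ʳ-here) m₄))
        (inc-spec e)
    addSucBit true (e ∷ e′ ∷ _) R₃ v m =
      inc-spec e ▷ λ R₄ (d , m₄) →
      reaches-map (λ R₅ (d′ , m₅) →
          trans d′ (cong suc (trans d (cong suc v))) ,
          modifies-trans m (modifies-trans (modifies-⊆ (⊆ʳ-singleton ∈ʳ-here) m₄) (modifies-⊆ (⊆ʳ-singleton ∈ʳ-here) m₅)))
        (inc-spec e′)

  popUnary-spec : ∀ {o S V H ex} → Placed P o (popUnaryCode o S V H ex) → S ≢ V → S ≢ H → V ≢ H →
    ∀ s R → R S ≡ toℕ s →
    Reaches R o ex (λ R′ → R′ S ≡ toℕ (proj₂ (popUnary s)) × R′ V ≡ proj₁ (popUnary s) ×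
                          Modifies (S ∷ V ∷ H ∷ []) R R′)
  popUnary-spec {o} {S} {V} {H} {ex} pl S≢V S≢H V≢H s R h
    with placed-++ P o (clearCode o V) pl
  ... | p₁ , pl₁ with placed-++ P (1 + o) (readBitCode (1 + o) S H ex ex (10 + o)) pl₁
  ... | p₂ , (e ∷ _) =
    clear-spec p₁ R ▷ λ R₁ (a , m) →
    reaches-map (λ R₂ (c₀ , c₁ , m₂) →
        c₀ , trans c₁ (cong (_+ proj₁ (popUnary s)) a) ,
        modifies-trans (modifies-⊆ (⊆ʳ-singleton (∈ʳ-there ∈ʳ-here)) m) m₂)
      (loop s R₁ (trans (unmodified₁ m S≢V) h))
    where
    V-kept : ∀ {R R₁} → Modifies (S ∷ H ∷ []) R R₁ → R₁ V ≡ R V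
    V-kept m = unmodified₂ m (≢-sym S≢V) V≢H
    SH⊆SVH : (S ∷ H ∷ []) ⊆ʳ (S ∷ V ∷ H ∷ [])
    SH⊆SVH = ⊆ʳ-∷ ∈ʳ-here (⊆ʳ-singleton (∈ʳ-there (∈ʳ-there ∈ʳ-here)))
    loop : ∀ s R → R S ≡ toℕ s →
      Reaches R (1 + o) ex (λ R′ → R′ S ≡ toℕ (proj₂ (popUnary s)) × R′ V ≡ R V + proj₁ (popUnary s) ×
                                  Modifies (S ∷ V ∷ H ∷ []) R R′)
    loop [] R h =
      reaches-map (λ R₁ (a , m) → a , trans (V-kept m) (sym (+-identityʳ (R V))) , modifies-⊆ SH⊆SVH m)
        (readBit-spec p₂ S≢H [] R h)
    loop (false ∷ t) R h =
      reaches-map (λ R₁ (a , m) → a , trans (V-kept m) (sym (+-identityʳ (R V))) , modifies-⊆ SH⊆SVH m)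
        (readBit-spec p₂ S≢H (false ∷ t) R h)
    loop (true ∷ t) R h =
      readBit-spec p₂ S≢H (true ∷ t) R h ▷ λ R₁ (a , m) →
      inc-spec e ▷ λ R₂ (b , m₂) →
      reaches-map (λ R₃ (c₀ , c₁ , m₃) →
          c₀ ,
          trans c₁ (trans (cong (_+ proj₁ (popUnary t)) (trans b (cong suc (V-kept m))))
                          (sym (+-suc (R V) _))) ,
          modifies-trans (modifies-⊆ SH⊆SVH m)
            (modifies-trans (modifies-⊆ (⊆ʳ-singleton (∈ʳ-there ∈ʳ-here)) m₂) m₃))
        (loop t R₂ (trans (unmodified₁ m₂ S≢V) a))

  pushUnary-spec : ∀ {o V S H ex} → Placed P o (pushUnaryCode o V S H ex) → S ≢ V → S ≢ H → V ≢ H →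
    ∀ s R → R S ≡ toℕ s →
    Reaches R o ex (λ R′ → R′ S ≡ toℕ (R V ∷ᵘ s) × R′ V ≡ 0 × Modifies (S ∷ V ∷ H ∷ []) R R′)
  pushUnary-spec {o} {V} {S} {H} {ex} pl S≢V S≢H V≢H s R h
    with placed-++ P o (pushBitCode o S H false (7 + o)) pl
  ... | p₁ , (e ∷ p₂) =
    pushBit-spec false p₁ S≢H s R h ▷ λ R₁ (a , m) →
    reaches-map (λ R₂ (c₀ , c₁ , m₂) →
        trans c₀ (cong (λ n → toℕ (n ∷ᵘ s)) (V-kept m)) , c₁ , modifies-trans (modifies-⊆ SH⊆SVH m) m₂)
      (loop (R₁ V) (false ∷ s) R₁ refl a)
    where
    V-kept : ∀ {R R₁} → Modifies (S ∷ H ∷ []) R R₁ → R₁ V ≡ R V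
    V-kept m = unmodified₂ m (≢-sym S≢V) V≢H
    SH⊆SVH : (S ∷ H ∷ []) ⊆ʳ (S ∷ V ∷ H ∷ [])
    SH⊆SVH = ⊆ʳ-∷ ∈ʳ-here (⊆ʳ-singleton (∈ʳ-there (∈ʳ-there ∈ʳ-here)))
    loop : ∀ n u R → R V ≡ n → R S ≡ toℕ u →
      Reaches R (7 + o) ex (λ R′ → R′ S ≡ toℕ (replicate n true ++ u) × R′ V ≡ 0 × Modifies (S ∷ V ∷ H ∷ []) R R′)
    loop zero    u R hV hS = decjz-zero-spec e hV (hS , hV , modifies-refl)
    loop (suc n) u R hV hS =
      decjz-suc-spec e hV ▷ λ R₁ (a , m₁) →
      pushBit-spec true p₂ S≢H u R₁ (trans (unmodified₁ m₁ S≢V) hS) ▷ λ R₂ (b , m₂) →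
      reaches-map (λ R₃ (c₀ , c₁ , m₃) →
          trans c₀ (cong toℕ (replicate-true-snoc n u)) , c₁ ,
          modifies-trans (modifies-⊆ (⊆ʳ-singleton (∈ʳ-there ∈ʳ-here)) m₁)
            (modifies-trans (modifies-⊆ SH⊆SVH m₂) m₃))
        (loop n (true ∷ u) R₂ (trans (V-kept m₂) a) b)

  search-spec : ∀ {o V ex} → Placed P o (searchCode o V ex) → ∀ d R → Y (R V + d) ≡ true →
    Reaches R o ex (λ R′ → R′ V ≡ firstIn Y d (R V) × Modifies (V ∷ []) R R′)
  search-spec {o} {V} (e₀ ∷ e₁ ∷ _) zero R h =
    R , (refl , modifies-refl) , orc-true-steps e₀ (trans (cong Y (sym (+-identityʳ (R V)))) h)
  search-spec {o} {V} pl@(e₀ ∷ e₁ ∷ _) (suc d) R h with Y (R V) in y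
  ... | true  = R , (refl , modifies-refl) , orc-true-steps e₀ y
  ... | false =
    steps-reaches (orc-false-steps e₀ y)
      (inc-spec e₁ ▷ λ R₁ (a , m₁) →
       reaches-map (λ R₂ (b , m₂) → trans b (cong (firstIn Y d) a) , modifies-trans m₁ m₂)
         (search-spec pl d R₁ (trans (cong Y (trans (cong (_+ d) a) (sym (+-suc (R V) d)))) h)))

  transfer-spec : ∀ {o A B K U H ex} → Placed P o (transferCode o A B K U H ex) →
    AllPairs _≢_ (A ∷ B ∷ K ∷ U ∷ H ∷ []) →
    ∀ LA LB R → R A ≡ toℕ (unaryList LA) → R B ≡ toℕ (unaryList LB) →
    Reaches R o ex (λ R′ → R′ A ≡ toℕ (unaryList (drop0 (R K) LA)) ×
                          R′ B ≡ toℕ (unaryList (take0 (R K) LA ʳ++ LB)) ×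
                          Modifies (A ∷ B ∷ K ∷ U ∷ H ∷ []) R R′)
  transfer-spec {o} {A} {B} {K} {U} {H} {ex} (e₀ ∷ pl)
    ((A≢B ∷ A≢K ∷ A≢U ∷ A≢H ∷ []) ∷ (B≢K ∷ B≢U ∷ B≢H ∷ []) ∷ (K≢U ∷ K≢H ∷ []) ∷ (U≢H ∷ []) ∷ [] ∷ [])
    LA LB R hA hB
    with placed-++ P (1 + o) (popUnaryCode (1 + o) A U H (12 + o)) pl
  ... | p₁ , p₂ = loop (R K) LA LB R refl hA hB
    where
    loop : ∀ k LA LB R → R K ≡ k → R A ≡ toℕ (unaryList LA) → R B ≡ toℕ (unaryList LB) →
      Reaches R o ex (λ R′ → R′ A ≡ toℕ (unaryList (drop0 k LA)) × R′ B ≡ toℕ (unaryList (take0 k LA ʳ++ LB)) ×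
                            Modifies (A ∷ B ∷ K ∷ U ∷ H ∷ []) R R′)
    loop zero    LA LB R hK hA hB = decjz-zero-spec e₀ hK (hA , hB , modifies-refl)
    loop (suc k) LA LB R hK hA hB =
      decjz-suc-spec e₀ hK ▷ λ R₁ (a , m₁) →
      popUnary-spec p₁ A≢U A≢H U≢H (unaryList LA) R₁ (trans (unmodified₁ m₁ A≢K) hA) ▷ λ R₂ (b₀ , b₁ , m₂) →
      pushUnary-spec p₂ B≢U B≢H U≢H (unaryList LB) R₂
        (trans (unmodified₃ m₂ (≢-sym A≢B) B≢U B≢H) (trans (unmodified₁ m₁ B≢K) hB)) ▷ λ R₃ (c₀ , c₁ , m₃) →
      reaches-map (λ R₄ (d₀ , d₁ , m₄) →
          d₀ , d₁ ,
          modifies-trans (modifies-⊆ (⊆ʳ-singleton K∈) m₁)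
            (modifies-trans (modifies-⊆ (⊆ʳ-∷ ∈ʳ-here (⊆ʳ-∷ U∈ (⊆ʳ-singleton H∈))) m₂)
              (modifies-trans (modifies-⊆ (⊆ʳ-∷ (∈ʳ-there ∈ʳ-here) (⊆ʳ-∷ U∈ (⊆ʳ-singleton H∈))) m₃) m₄)))
        (loop k (tail0 LA) (head0 LA ∷ LB) R₃
          (trans (unmodified₃ m₃ (≢-sym B≢K) K≢U K≢H) (trans (unmodified₃ m₂ (≢-sym A≢K) K≢U K≢H) a))
          (trans (unmodified₃ m₃ A≢B A≢U A≢H) (trans b₀ (cong (toℕ ∘ proj₂) (popUnary-unaryList LA))))
          (trans c₀ (cong (λ n → toℕ (n ∷ᵘ unaryList LB)) (trans b₁ (cong proj₁ (popUnary-unaryList LA))))))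
      where
      K∈ : K ∈ʳ (A ∷ B ∷ K ∷ U ∷ H ∷ [])
      K∈ = ∈ʳ-there (∈ʳ-there ∈ʳ-here)
      U∈ : U ∈ʳ (A ∷ B ∷ K ∷ U ∷ H ∷ [])
      U∈ = ∈ʳ-there (∈ʳ-there (∈ʳ-there ∈ʳ-here))
      H∈ : H ∈ʳ (A ∷ B ∷ K ∷ U ∷ H ∷ [])
      H∈ = ∈ʳ-there (∈ʳ-there (∈ʳ-there (∈ʳ-there ∈ʳ-here)))

  lookup-spec : ∀ {o ex} → Placed P o (lookupCode o ex) → ∀ L R → R 2 ≡ toℕ (unaryList L) →
    Reaches R o ex (λ R′ → R′ 12 ≡ nth0 L (R 13) × Modifies (11 ∷ 12 ∷ 13 ∷ 14 ∷ 15 ∷ 17 ∷ 19 ∷ []) R R′)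
  lookup-spec {o} {ex} pl L R h
    with placed-++ P o (copyCode o 2 14 19 (7 + o)) pl
  ... | p₁ , pl₁ with placed-++ P (7 + o) (clearCode (7 + o) 15) pl₁
  ... | p₂ , pl₂ with placed-++ P (8 + o) (transferCode (8 + o) 14 15 13 17 11 (36 + o)) pl₂
  ... | p₃ , p₄ =
    copy-spec p₁ (λ ()) (λ ()) (λ ()) R ▷ λ R₁ (a₀ , a₁ , _ , m₁) →
    clear-spec p₂ R₁ ▷ λ R₂ (b₀ , m₂) →
    transfer-spec p₃ (from-yes (distinct? (14 ∷ 15 ∷ 13 ∷ 17 ∷ 11 ∷ []))) L [] R₂ (trans (unmodified m₂ 14 tt) (trans a₀ h)) b₀
      ▷ λ R₃ (c₀ , _ , m₃) →
    reaches-map (λ R₄ (_ , d₁ , m₄) →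
        trans d₁ (trans (cong proj₁ (popUnary-unaryList (drop0 (R₂ 13) L)))
          (trans (head0-drop0 (R₂ 13) L) (cong (nth0 L) (unmodified (m₁ ⨾ m₂) 13 tt)))) ,
        modifies-⊆ᵇ tt (modifies-restore m₁ a₁ ⨾ m₂ ⨾ m₃ ⨾ m₄))
      (popUnary-spec p₄ (λ ()) (λ ()) (λ ()) (unaryList (drop0 (R₂ 13) L)) R₃ c₀)

  store-spec : ∀ {o ex} → Placed P o (storeCode o ex) → ∀ L R → R 2 ≡ toℕ (unaryList L) →
    Reaches R o ex (λ R′ → R′ 2 ≡ toℕ (unaryList (setNth0 L (R 13) (R 12))) ×
                          Modifies (2 ∷ 11 ∷ 12 ∷ 13 ∷ 16 ∷ 17 ∷ 18 ∷ 19 ∷ []) R R′)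
  store-spec {o} {ex} pl L R h
    with placed-++ P o (copyCode o 13 18 19 (7 + o)) pl
  ... | p₁ , pl₁ with placed-++ P (7 + o) (clearCode (7 + o) 16) pl₁
  ... | p₂ , pl₂ with placed-++ P (8 + o) (transferCode (8 + o) 2 16 13 17 11 (36 + o)) pl₂
  ... | p₃ , pl₃ with placed-++ P (36 + o) (popUnaryCode (36 + o) 2 17 11 (47 + o)) pl₃
  ... | p₄ , pl₄ with placed-++ P (47 + o) (pushUnaryCode (47 + o) 12 2 11 (63 + o)) pl₄
  ... | p₅ , p₆ =
    copy-spec p₁ (λ ()) (λ ()) (λ ()) R ▷ λ R₁ (a₀ , a₁ , _ , m₁) →
    clear-spec p₂ R₁ ▷ λ R₂ (b₀ , m₂) →
    transfer-spec p₃ (from-yes (distinct? (2 ∷ 16 ∷ 13 ∷ 17 ∷ 11 ∷ []))) L [] R₂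
      (trans (unmodified (m₁ ⨾ m₂) 2 tt) h) b₀ ▷ λ R₃ (c₀ , c₁ , m₃) →
    popUnary-spec p₄ (λ ()) (λ ()) (λ ()) _ R₃ c₀ ▷ λ R₄ (d₀ , _ , m₄) →
    pushUnary-spec p₅ (λ ()) (λ ()) (λ ()) _ R₄ d₀ ▷ λ R₅ (e₀ , _ , m₅) →
    reaches-map (λ R₆ (_ , g₁ , m₆) →
        let i≡ : R₂ 13 ≡ R 13
            i≡ = trans (unmodified m₂ 13 tt) a₁
            counter≡ : R₅ 18 ≡ R₂ 13
            counter≡ = trans (unmodified (m₂ ⨾ m₃ ⨾ m₄ ⨾ m₅) 18 tt) (trans a₀ (sym i≡))
            v≡ : R₄ 12 ≡ R 12
            v≡ = unmodified (m₁ ⨾ m₂ ⨾ m₃ ⨾ m₄) 12 tt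
        in
        trans g₁ (cong (toℕ ∘ unaryList)
          (trans (cong (λ k → take0 k (take0 (R₂ 13) L ʳ++ []) ʳ++ (R₄ 12 ∷ tail0 (drop0 (R₂ 13) L))) counter≡)
          (trans (take0-ʳ++-take0 (R₂ 13) L _) (cong₂ (setNth0 L) i≡ v≡)))) ,
        modifies-⊆ᵇ tt (modifies-restore m₁ a₁ ⨾ m₂ ⨾ m₃ ⨾ m₄ ⨾ m₅ ⨾ m₆))
      (transfer-spec p₆ (from-yes (distinct? (16 ∷ 2 ∷ 18 ∷ 17 ∷ 11 ∷ []))) (take0 (R₂ 13) L ʳ++ [])
        (R₄ 12 ∷ tail0 (drop0 (R₂ 13) L)) R₅
        (trans (unmodified (m₄ ⨾ m₅) 16 tt) c₁)
        (trans e₀ (cong (λ z → toℕ (R₄ 12 ∷ᵘ z)) (cong proj₂ (popUnary-unaryList (drop0 (R₂ 13) L))))))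

  decodeArgs-spec : ∀ {o ex} → Placed P o (decodeArgsCode o ex) → ∀ t R → R 5 ≡ toℕ t →
    Reaches R o ex (λ R′ → R′ 5 ≡ toℕ (rest₃ t) × R′ 8 ≡ arg₁ t × R′ 9 ≡ arg₂ t × R′ 10 ≡ arg₃ t ×
                          Modifies (5 ∷ 8 ∷ 9 ∷ 10 ∷ 11 ∷ []) R R′)
  decodeArgs-spec {o} {ex} pl t R h
    with placed-++ P o (popUnaryCode o 5 8 11 (11 + o)) pl
  ... | p₁ , pl₁ with placed-++ P (11 + o) (popUnaryCode (11 + o) 5 9 11 (22 + o)) pl₁
  ... | p₂ , p₃ =
    popUnary-spec p₁ (λ ()) (λ ()) (λ ()) t R h ▷ λ R₁ (a₀ , a₁ , m₁) →
    popUnary-spec p₂ (λ ()) (λ ()) (λ ()) (rest₁ t) R₁ a₀ ▷ λ R₂ (b₀ , b₁ , m₂) →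
    reaches-map (λ R₃ (c₀ , c₁ , m₃) →
        c₀ , trans (unmodified (m₂ ⨾ m₃) 8 tt) a₁ , trans (unmodified m₃ 9 tt) b₁ , c₁ , modifies-⊆ᵇ tt (m₁ ⨾ m₂ ⨾ m₃))
      (popUnary-spec p₃ (λ ()) (λ ()) (λ ()) (rest₂ t) R₂ b₀)

  parseInstrRegs : List ℕ
  parseInstrRegs = 5 ∷ 7 ∷ 8 ∷ 9 ∷ 10 ∷ 11 ∷ 19 ∷ 20 ∷ []

  record ParseInstrLayout (o exEnd exInc exDecjz exOrc exHalt : ℕ) : Set where
    field
      readBitAt  : Placed P o (readBitCode o 5 11 exEnd exEnd (9 + o))
      opcodeAt   : Placed P (9 + o) (popUnaryCode (9 + o) 5 7 11 (20 + o))
      copy₁At    : Placed P (20 + o) (copyCode (20 + o) 7 20 19 (27 + o))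
      dispatchAt : Placed P (27 + o) (dispatchCode o exHalt)
      incArg₁At  : Placed P (30 + o) (popUnaryCode (30 + o) 5 8 11 (41 + o))
      incArg₂At  : Placed P (41 + o) (popUnaryCode (41 + o) 5 9 11 exInc)
      argsAt     : Placed P (52 + o) (decodeArgsCode (52 + o) (85 + o))
      copy₂At    : Placed P (85 + o) (copyCode (85 + o) 7 20 19 (92 + o))
      testsAt    : Placed P (92 + o) (decjz 20 (93 + o) exHalt ∷ decjz 20 exOrc exDecjz ∷ [])

  parseInstr-layout : ∀ {o exEnd exInc exDecjz exOrc exHalt} →
    Placed P o (parseInstrCode o exEnd exInc exDecjz exOrc exHalt) → ParseInstrLayout o exEnd exInc exDecjz exOrc exHalt
  parseInstr-layout {o} {exEnd} {exInc} {exDecjz} {exOrc} {exHalt} pl =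
    let (q₁ , pl₁) = placed-++ P o (readBitCode o 5 11 exEnd exEnd (9 + o)) pl
        (q₂ , pl₂) = placed-++ P (9 + o) (popUnaryCode (9 + o) 5 7 11 (20 + o)) pl₁
        (q₃ , pl₃) = placed-++ P (20 + o) (copyCode (20 + o) 7 20 19 (27 + o)) pl₂
        (q₄ , pl₄) = placed-++ P (27 + o) (dispatchCode o exHalt) pl₃
        (q₅ , pl₅) = placed-++ P (30 + o) (popUnaryCode (30 + o) 5 8 11 (41 + o)) pl₄
        (q₆ , pl₆) = placed-++ P (41 + o) (popUnaryCode (41 + o) 5 9 11 exInc) pl₅
        (q₇ , pl₇) = placed-++ P (52 + o) (decodeArgsCode (52 + o) (85 + o)) pl₆
        (q₈ , q₉) = placed-++ P (85 + o) (copyCode (85 + o) 7 20 19 (92 + o)) pl₇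
    in record
      { readBitAt = q₁ ; opcodeAt = q₂ ; copy₁At = q₃ ; dispatchAt = q₄ ; incArg₁At = q₅ ; incArg₂At = q₆
      ; argsAt = q₇ ; copy₂At = q₈ ; testsAt = q₉ }

  module _ {o exEnd exInc exDecjz exOrc exHalt} (layout : ParseInstrLayout o exEnd exInc exDecjz exOrc exHalt) where
    open ParseInstrLayout layout

    threeArgs-spec : ∀ op t R → R 5 ≡ toℕ t → R 7 ≡ suc op →
      Reaches R (52 + o) (92 + o) (λ R′ → R′ 5 ≡ toℕ (rest₃ t) × R′ 8 ≡ arg₁ t × R′ 9 ≡ arg₂ t × R′ 10 ≡ arg₃ t ×
                                         R′ 20 ≡ suc op × Modifies parseInstrRegs R R′)
    threeArgs-spec op t R h₅ h₇ =
      decodeArgs-spec argsAt t R h₅ ▷ λ R₁ (a₀ , a₁ , a₂ , a₃ , m₁) →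
      reaches-map (λ R₂ (b₀ , b₁ , _ , m₂) →
          trans (unmodified m₂ 5 tt) a₀ , trans (unmodified m₂ 8 tt) a₁ , trans (unmodified m₂ 9 tt) a₂ ,
          trans (unmodified m₂ 10 tt) a₃ , trans b₀ (trans (unmodified m₁ 7 tt) h₇) ,
          modifies-⊆ᵇ tt (m₁ ⨾ modifies-restore m₂ b₁))
        (copy-spec copy₂At (λ ()) (λ ()) (λ ()) R₁)

    -- Register 20 counts the opcode down; opcodes 1 and 2 share the decoding of
    -- their arguments and are told apart afterwards by the second copy.
    dispatch-spec : ∀ op t R → R 20 ≡ op → R 7 ≡ op → R 5 ≡ toℕ t →
      Reaches R (27 + o) (exitFor exEnd exInc exDecjz exOrc exHalt (instrWithOpcode op t))
        (λ R′ → ParsedInRegs (instrWithOpcode op t) R′ × Modifies parseInstrRegs R R′)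
    dispatch-spec op t R h₂₀ h₇ h₅ with dispatchAt | testsAt
    ... | d₀ ∷ d₁ ∷ d₂ ∷ [] | t₁ ∷ t₂ ∷ [] = go op h₂₀ h₇
      where
      go : ∀ op → R 20 ≡ op → R 7 ≡ op →
        Reaches R (27 + o) (exitFor exEnd exInc exDecjz exOrc exHalt (instrWithOpcode op t))
          (λ R′ → ParsedInRegs (instrWithOpcode op t) R′ × Modifies parseInstrRegs R R′)
      go zero h₂₀ h₇ =
        steps-reaches (decjz-zero-steps d₀ h₂₀)
          (popUnary-spec incArg₁At (λ ()) (λ ()) (λ ()) t R h₅ ▷ λ R₁ (a₀ , a₁ , m₁) →
           reaches-map (λ R₂ (b₀ , b₁ , m₂) →
               (b₀ , trans (unmodified m₂ 8 tt) a₁ , b₁) , modifies-⊆ᵇ tt (m₁ ⨾ m₂))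
             (popUnary-spec incArg₂At (λ ()) (λ ()) (λ ()) (rest₁ t) R₁ a₀))
      go (suc zero) h₂₀ h₇ =
        decjz-suc-spec d₀ h₂₀ ▷ λ R₁ (a₀ , m₁) →
        steps-reaches (decjz-zero-steps d₁ a₀)
          (threeArgs-spec 0 t R₁ (trans (unmodified m₁ 5 tt) h₅) (trans (unmodified m₁ 7 tt) h₇)
             ▷ λ R₂ (b₀ , b₁ , b₂ , b₃ , b₄ , m₂) →
           decjz-suc-spec t₁ b₄ ▷ λ R₃ (c₀ , m₃) →
           decjz-zero-spec t₂ c₀
             ((trans (unmodified m₃ 5 tt) b₀ , trans (unmodified m₃ 8 tt) b₁ ,
               trans (unmodified m₃ 9 tt) b₂ , trans (unmodified m₃ 10 tt) b₃) ,
              modifies-⊆ᵇ tt (m₁ ⨾ m₂ ⨾ m₃)))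
      go (suc (suc zero)) h₂₀ h₇ =
        decjz-suc-spec d₀ h₂₀ ▷ λ R₁ (a₀ , m₁) →
        decjz-suc-spec d₁ a₀ ▷ λ R₂ (a₁ , m₂) →
        steps-reaches (decjz-zero-steps d₂ a₁)
          (threeArgs-spec 1 t R₂ (trans (unmodified (m₁ ⨾ m₂) 5 tt) h₅) (trans (unmodified (m₁ ⨾ m₂) 7 tt) h₇)
             ▷ λ R₃ (b₀ , b₁ , b₂ , b₃ , b₄ , m₃) →
           decjz-suc-spec t₁ b₄ ▷ λ R₄ (c₀ , m₄) →
           reaches-map (λ R₅ (_ , m₅) →
               (trans (unmodified (m₄ ⨾ m₅) 5 tt) b₀ , trans (unmodified (m₄ ⨾ m₅) 8 tt) b₁ ,
                trans (unmodified (m₄ ⨾ m₅) 9 tt) b₂ , trans (unmodified (m₄ ⨾ m₅) 10 tt) b₃) ,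
               modifies-⊆ᵇ tt (m₁ ⨾ m₂ ⨾ m₃ ⨾ m₄ ⨾ m₅))
             (decjz-suc-spec t₂ c₀))
      go (suc (suc (suc op))) h₂₀ h₇ =
        decjz-suc-spec d₀ h₂₀ ▷ λ R₁ (a₀ , m₁) →
        decjz-suc-spec d₁ a₀ ▷ λ R₂ (a₁ , m₂) →
        reaches-map (λ R₃ (_ , m₃) →
            trans (unmodified (m₁ ⨾ m₂ ⨾ m₃) 5 tt) h₅ ,
            modifies-⊆ᵇ tt (m₁ ⨾ m₂ ⨾ m₃))
          (decjz-suc-spec d₂ a₁)

  parseInstr-spec : ∀ {o exEnd exInc exDecjz exOrc exHalt} →
    Placed P o (parseInstrCode o exEnd exInc exDecjz exOrc exHalt) → ∀ s R → R 5 ≡ toℕ s →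
    Reaches R o (exitFor exEnd exInc exDecjz exOrc exHalt (parseInstr s))
      (λ R′ → ParsedInRegs (parseInstr s) R′ × Modifies parseInstrRegs R R′)
  parseInstr-spec {o} {exEnd} {exInc} {exDecjz} {exOrc} {exHalt} pl s R h = go s h
    where
    layout = parseInstr-layout pl
    open ParseInstrLayout layout
    go : ∀ s → R 5 ≡ toℕ s → Reaches R o (exitFor exEnd exInc exDecjz exOrc exHalt (parseInstr s))
           (λ R′ → ParsedInRegs (parseInstr s) R′ × Modifies parseInstrRegs R R′)
    go [] h = reaches-map (λ R′ (a , m) → a , modifies-⊆ᵇ tt m) (readBit-spec readBitAt (λ ()) [] R h)
    go (false ∷ t) h = reaches-map (λ R′ (a , m) → a , modifies-⊆ᵇ tt m) (readBit-spec readBitAt (λ ()) (false ∷ t) R h)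
    go (true ∷ t) h =
      readBit-spec readBitAt (λ ()) (true ∷ t) R h ▷ λ R₁ (a , m₁) →
      popUnary-spec opcodeAt (λ ()) (λ ()) (λ ()) t R₁ a ▷ λ R₂ (b₀ , b₁ , m₂) →
      copy-spec copy₁At (λ ()) (λ ()) (λ ()) R₂ ▷ λ R₃ (c₀ , c₁ , _ , m₃) →
      reaches-map (λ R′ (p , m) → p , modifies-trans (modifies-⊆ᵇ tt (m₁ ⨾ m₂ ⨾ m₃)) m)
        (dispatch-spec layout (proj₁ (popUnary t)) (proj₂ (popUnary t)) R₃
          (trans c₀ b₁) (trans c₁ b₁) (trans (unmodified m₃ 5 tt) b₀))

-- The interpreter

-- Registers of Q: 0 holds its input p = (program ++ data) and finally the
-- output; 2 the simulated registers as a `unaryList`; 3 the simulated pc;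
-- 4 the element of the oracle found first; 5 a cursor into p; 6 an
-- instruction counter; 7–10 the opcode and arguments of an instruction;
-- 12, 13 the value and index for `lookupCode`/`storeCode`; the others scratch.
-- Control: 0–8 find that element and copy p to the cursor; 9–102 skip the
-- program part of p; 103–136 store the initial registers [data, element] and
-- set the pc to 0; 137–248 fetch the instruction at the pc; 249, 301, 457 and
-- 616 execute halt, inc, decjz and orc. The simulated machine runs without
-- oracle, so `orc` always takes its second branch.
Q : Prog
Q = searchCode 0 4 2 ++
    copyCode 2 0 5 19 9 ++
    parseInstrCode 9 103 9 9 9 9 ++
    clearCode 103 2 ++
    pushUnaryCode 104 4 2 11 120 ++
    pushUnaryCode 120 5 2 11 136 ++
    clearCode 136 3 ++
    copyCode 137 0 5 19 144 ++
    copyCode 144 3 6 19 151 ++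
    parseInstrCode 151 249 245 246 247 248 ++
    (decjz 6 151 301 ∷ decjz 6 151 457 ∷ decjz 6 151 616 ∷ decjz 6 151 249 ∷ []) ++
    clearCode 249 13 ++ lookupCode 250 297 ++ clearCode 297 0 ++ addCode 298 12 0 300 ++ (halt ∷ []) ++
    copyCode 301 8 13 19 308 ++ lookupCode 308 355 ++ (inc 12 356 ∷ []) ++ copyCode 356 8 13 19 363 ++
    storeCode 363 454 ++ clearCode 454 3 ++ addCode 455 9 3 137 ++
    copyCode 457 8 13 19 464 ++ lookupCode 464 511 ++ (decjz 12 512 613 ∷ []) ++ copyCode 512 8 13 19 519 ++
    storeCode 519 610 ++ clearCode 610 3 ++ addCode 611 9 3 137 ++
    clearCode 613 3 ++ addCode 614 10 3 137 ++
    clearCode 616 3 ++ addCode 617 10 3 137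

execAt : Instr → ℕ
execAt (inc _ _)     = 301
execAt (decjz _ _ _) = 457
execAt (orc _ _ _)   = 616
execAt halt          = 249

fetchExit skipExit : Parsed → ℕ
fetchExit = exitFor 249 245 246 247 248
skipExit  = exitFor 103 9 9 9 9

fetch-test : ∀ i t → lookupI Q (fetchExit (instr i t)) ≡ decjz 6 151 (execAt i)
fetch-test (inc _ _)     t = refl
fetch-test (decjz _ _ _) t = refl
fetch-test (orc _ _ _)   t = refl
fetch-test halt          t = refl

ArgsInRegs : Instr → Regs → Set
ArgsInRegs (inc r j)     R = R 8 ≡ r × R 9 ≡ j
ArgsInRegs (decjz r j k) R = R 8 ≡ r × R 9 ≡ j × R 10 ≡ k
ArgsInRegs (orc r j k)   R = R 8 ≡ r × R 9 ≡ j × R 10 ≡ k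
ArgsInRegs halt          R = ⊤

parsed⇒args : ∀ i t R → ParsedInRegs (instr i t) R → ArgsInRegs i R
parsed⇒args (inc r j)     t R (_ , a) = a
parsed⇒args (decjz r j k) t R (_ , a) = a
parsed⇒args (orc r j k)   t R (_ , a) = a
parsed⇒args halt          t R _       = tt

parsed⇒rest : ∀ i t R → ParsedInRegs (instr i t) R → R 5 ≡ toℕ t
parsed⇒rest (inc r j)     t R (a , _) = a
parsed⇒rest (decjz r j k) t R (a , _) = a
parsed⇒rest (orc r j k)   t R (a , _) = a
parsed⇒rest halt          t R a       = a

record KeepsState (R R′ : Regs) : Set where
  constructor mkKeeps
  field
    input-kept : R′ 0 ≡ R 0
    regs-kept  : R′ 2 ≡ R 2
    pc-kept    : R′ 3 ≡ R 3
open KeepsState public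

keeps-refl : ∀ {R} → KeepsState R R
keeps-refl = mkKeeps refl refl refl

keeps-trans : ∀ {R R₁ R₂} → KeepsState R R₁ → KeepsState R₁ R₂ → KeepsState R R₂
keeps-trans (mkKeeps a b c) (mkKeeps a′ b′ c′) = mkKeeps (trans a′ a) (trans b′ b) (trans c′ c)

modifies⇒keeps : ∀ {ms R R′} → T (0 ∉ᵇ ms) → T (2 ∉ᵇ ms) → T (3 ∉ᵇ ms) → Modifies ms R R′ → KeepsState R R′
modifies⇒keeps h₀ h₂ h₃ m = mkKeeps (unmodified m 0 h₀) (unmodified m 2 h₂) (unmodified m 3 h₃)

Represents : List ℕ → Regs → Set
Represents L R = ∀ i → nth0 L i ≡ R i

represents-set : ∀ {L R} r v → Represents L R → Represents (setNth0 L r v) (set R r v)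
represents-set {L} r v rep i = trans (nth0-setNth0 r L v i) (cong (if i ≡ᵇ r then v else_) (rep i))

represents-initRegs : ∀ d n → Represents (toℕ d ∷ n ∷ []) (initRegs d n)
represents-initRegs d n zero          = refl
represents-initRegs d n (suc zero)    = refl
represents-initRegs d n (suc (suc i)) = refl

module Interpreter (Y : Subset) where
  open Execution Y Q public

  fetch-spec : ∀ c f s {P d} R → parseProg' f s ≡ just (P , d) → R 5 ≡ toℕ s → R 6 ≡ c →
    Reaches R 151 (execAt (lookupI P c)) (λ R′ → ArgsInRegs (lookupI P c) R′ × KeepsState R R′)
  fetch-spec c f s R parsed h₅ h₆ with parseProg'-step f s parsed
  ... | inj₁ (e , refl) =
    reaches-map (λ R′ (_ , m) → tt , modifies⇒keeps tt tt tt m)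
      (subst (λ p → Reaches R 151 (fetchExit p) (λ R′ → ParsedInRegs p R′ × Modifies parseInstrRegs R R′)) e
        (parseInstr-spec (placed (parseInstrCode 151 249 245 246 247 248) refl) s R h₅))
  ... | inj₂ (i , t , P′ , f′ , e , refl , parsed′) =
    subst (λ p → Reaches R 151 (fetchExit p) (λ R′ → ParsedInRegs p R′ × Modifies parseInstrRegs R R′)) e
      (parseInstr-spec (placed (parseInstrCode 151 249 245 246 247 248) refl) s R h₅) ▷ λ R₁ (p , m) →
    reaches-map (λ R′ (a , k) → a , keeps-trans (modifies⇒keeps tt tt tt m) k)
      (select c R₁ p (trans (unmodified m 6 tt) h₆))
    where
    select : ∀ c R₁ → ParsedInRegs (instr i t) R₁ → R₁ 6 ≡ c →
      Reaches R₁ (fetchExit (instr i t)) (execAt (lookupI (i ∷ P′) c))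
        (λ R′ → ArgsInRegs (lookupI (i ∷ P′) c) R′ × KeepsState R₁ R′)
    select zero    R₁ p h₆ = decjz-zero-spec (fetch-test i t) h₆ (parsed⇒args i t R₁ p , keeps-refl)
    select (suc c) R₁ p h₆ =
      decjz-suc-spec (fetch-test i t) h₆ ▷ λ R₂ (a , m) →
      reaches-map (λ R′ (b , k) → b , keeps-trans (modifies⇒keeps tt tt tt m) k)
        (fetch-spec c f′ t R₂ parsed′ (trans (unmodified m 5 tt) (parsed⇒rest i t R₁ p)) a)

  inc-exec-spec : ∀ R r j L → R 8 ≡ r → R 9 ≡ j → R 2 ≡ toℕ (unaryList L) →
    Reaches R 301 137 (λ R′ → R′ 0 ≡ R 0 × R′ 2 ≡ toℕ (unaryList (setNth0 L r (suc (nth0 L r)))) × R′ 3 ≡ j)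
  inc-exec-spec R r j L h₈ h₉ h₂ =
    copy-spec (placed (copyCode 301 8 13 19 308) refl) (λ ()) (λ ()) (λ ()) R ▷ λ R₁ (a₀ , a₁ , _ , m₁) →
    lookup-spec (placed (lookupCode 308 355) refl) L R₁ (trans (unmodified m₁ 2 tt) h₂) ▷ λ R₂ (b₀ , m₂) →
    inc-spec {R = R₂} (refl {x = inc 12 356}) ▷ λ R₃ (c₀ , m₃) →
    copy-spec (placed (copyCode 356 8 13 19 363) refl) (λ ()) (λ ()) (λ ()) R₃ ▷ λ R₄ (d₀ , _ , _ , m₄) →
    store-spec (placed (storeCode 363 454) refl) L R₄ (trans (unmodified (m₁ ⨾ m₂ ⨾ m₃ ⨾ m₄) 2 tt) h₂)
      ▷ λ R₅ (e₀ , m₅) →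
    clear-spec (placed (clearCode 454 3) refl) R₅ ▷ λ R₆ (g₀ , m₆) →
    reaches-map (λ R₇ (_ , k₁ , m₇) →
        let index : R₄ 13 ≡ r
            index = trans d₀ (trans (unmodified (m₂ ⨾ m₃) 8 tt) (trans a₁ h₈))
            value : R₄ 12 ≡ suc (nth0 L r)
            value = trans (unmodified m₄ 12 tt) (trans c₀ (cong suc (trans b₀ (cong (nth0 L) (trans a₀ h₈)))))
        in
        unmodified (m₁ ⨾ m₂ ⨾ m₃ ⨾ m₄ ⨾ m₅ ⨾ m₆ ⨾ m₇) 0 tt ,
        trans (unmodified (m₆ ⨾ m₇) 2 tt) (trans e₀ (cong₂ (λ i v → toℕ (unaryList (setNth0 L i v))) index value)) ,
        trans k₁ (cong₂ _+_ g₀ (trans (unmodified (m₁ ⨾ m₂ ⨾ m₃ ⨾ m₄ ⨾ m₅ ⨾ m₆) 9 tt) h₉)))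
      (add-spec (placed (addCode 455 9 3 137) refl) (λ ()) R₆)

  decjz-suc-exec-spec : ∀ R r j L w → R 8 ≡ r → R 9 ≡ j → R 2 ≡ toℕ (unaryList L) → nth0 L r ≡ suc w →
    Reaches R 457 137 (λ R′ → R′ 0 ≡ R 0 × R′ 2 ≡ toℕ (unaryList (setNth0 L r w)) × R′ 3 ≡ j)
  decjz-suc-exec-spec R r j L w h₈ h₉ h₂ hw =
    copy-spec (placed (copyCode 457 8 13 19 464) refl) (λ ()) (λ ()) (λ ()) R ▷ λ R₁ (a₀ , a₁ , _ , m₁) →
    lookup-spec (placed (lookupCode 464 511) refl) L R₁ (trans (unmodified m₁ 2 tt) h₂) ▷ λ R₂ (b₀ , m₂) →
    decjz-suc-spec {R = R₂} (refl {x = decjz 12 512 613}) (trans b₀ (trans (cong (nth0 L) (trans a₀ h₈)) hw))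
      ▷ λ R₃ (c₀ , m₃) →
    copy-spec (placed (copyCode 512 8 13 19 519) refl) (λ ()) (λ ()) (λ ()) R₃ ▷ λ R₄ (d₀ , _ , _ , m₄) →
    store-spec (placed (storeCode 519 610) refl) L R₄ (trans (unmodified (m₁ ⨾ m₂ ⨾ m₃ ⨾ m₄) 2 tt) h₂)
      ▷ λ R₅ (e₀ , m₅) →
    clear-spec (placed (clearCode 610 3) refl) R₅ ▷ λ R₆ (g₀ , m₆) →
    reaches-map (λ R₇ (_ , k₁ , m₇) →
        let index : R₄ 13 ≡ r
            index = trans d₀ (trans (unmodified (m₂ ⨾ m₃) 8 tt) (trans a₁ h₈))
        in
        unmodified (m₁ ⨾ m₂ ⨾ m₃ ⨾ m₄ ⨾ m₅ ⨾ m₆ ⨾ m₇) 0 tt ,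
        trans (unmodified (m₆ ⨾ m₇) 2 tt)
          (trans e₀ (cong₂ (λ i v → toℕ (unaryList (setNth0 L i v))) index (trans (unmodified m₄ 12 tt) c₀))) ,
        trans k₁ (cong₂ _+_ g₀ (trans (unmodified (m₁ ⨾ m₂ ⨾ m₃ ⨾ m₄ ⨾ m₅ ⨾ m₆) 9 tt) h₉)))
      (add-spec (placed (addCode 611 9 3 137) refl) (λ ()) R₆)

  decjz-zero-exec-spec : ∀ R r k L → R 8 ≡ r → R 10 ≡ k → R 2 ≡ toℕ (unaryList L) → nth0 L r ≡ 0 →
    Reaches R 457 137 (λ R′ → R′ 0 ≡ R 0 × R′ 2 ≡ R 2 × R′ 3 ≡ k)
  decjz-zero-exec-spec R r k L h₈ h₁₀ h₂ hz =
    copy-spec (placed (copyCode 457 8 13 19 464) refl) (λ ()) (λ ()) (λ ()) R ▷ λ R₁ (a₀ , _ , _ , m₁) →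
    lookup-spec (placed (lookupCode 464 511) refl) L R₁ (trans (unmodified m₁ 2 tt) h₂) ▷ λ R₂ (b₀ , m₂) →
    steps-reaches (decjz-zero-steps {R = R₂} (refl {x = decjz 12 512 613})
                                    (trans b₀ (trans (cong (nth0 L) (trans a₀ h₈)) hz)))
      (clear-spec (placed (clearCode 613 3) refl) R₂ ▷ λ R₃ (c₀ , m₃) →
       reaches-map (λ R₄ (_ , d₁ , m₄) →
           unmodified (m₁ ⨾ m₂ ⨾ m₃ ⨾ m₄) 0 tt , unmodified (m₁ ⨾ m₂ ⨾ m₃ ⨾ m₄) 2 tt ,
           trans d₁ (cong₂ _+_ c₀ (trans (unmodified (m₁ ⨾ m₂ ⨾ m₃) 10 tt) h₁₀)))
         (add-spec (placed (addCode 614 10 3 137) refl) (λ ()) R₃))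

  orc-exec-spec : ∀ R k → R 10 ≡ k → Reaches R 616 137 (λ R′ → R′ 0 ≡ R 0 × R′ 2 ≡ R 2 × R′ 3 ≡ k)
  orc-exec-spec R k h₁₀ =
    clear-spec (placed (clearCode 616 3) refl) R ▷ λ R₁ (a₀ , m₁) →
    reaches-map (λ R₂ (_ , b₁ , m₂) →
        unmodified (m₁ ⨾ m₂) 0 tt , unmodified (m₁ ⨾ m₂) 2 tt , trans b₁ (cong₂ _+_ a₀ (trans (unmodified m₁ 10 tt) h₁₀)))
      (add-spec (placed (addCode 617 10 3 137) refl) (λ ()) R₁)

  halt-exec-halts : ∀ R L → R 2 ≡ toℕ (unaryList L) → Halts R 249 (nth0 L 0)
  halt-exec-halts R L h₂ =
    reaches-halts (clear-spec (placed (clearCode 249 13) refl) R) λ R₁ (a₀ , m₁) →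
    reaches-halts (lookup-spec (placed (lookupCode 250 297) refl) L R₁ (trans (unmodified m₁ 2 tt) h₂)) λ R₂ (b₀ , m₂) →
    reaches-halts (clear-spec (placed (clearCode 297 0) refl) R₂) λ R₃ (c₀ , m₃) →
    reaches-halts (add-spec (placed (addCode 298 12 0 300) refl) (λ ()) R₃) λ R₄ (_ , d₁ , m₄) →
    subst (Halts R₄ 300) (trans d₁ (cong₂ _+_ c₀ (trans (unmodified m₃ 12 tt) (trans b₀ (cong (nth0 L) a₀)))))
      (halt-halts refl)

  module Simulation {p P d f} (parsed : parseProg' f p ≡ just (P , d)) where

    fetch-current-spec : ∀ R pc {i} → R 0 ≡ toℕ p → R 3 ≡ pc → lookupI P pc ≡ i →
      Reaches R 137 (execAt i) (λ R′ → ArgsInRegs i R′ × KeepsState R R′)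
    fetch-current-spec R pc h₀ h₃ refl =
      copy-spec (placed (copyCode 137 0 5 19 144) refl) (λ ()) (λ ()) (λ ()) R ▷ λ R₁ (a₀ , a₁ , _ , m₁) →
      copy-spec (placed (copyCode 144 3 6 19 151) refl) (λ ()) (λ ()) (λ ()) R₁ ▷ λ R₂ (b₀ , b₁ , _ , m₂) →
      reaches-map (λ R′ (args , k) → args ,
          keeps-trans (modifies⇒keeps tt tt tt (modifies-restore m₁ a₁ ⨾ modifies-restore m₂ b₁)) k)
        (fetch-spec pc f p R₂ parsed (trans (unmodified m₂ 5 tt) (trans a₀ h₀))
          (trans b₀ (trans (unmodified m₁ 3 tt) h₃)))

    simulate : ∀ fuel RP pc S → run emptyOracle P fuel RP pc ≡ just S →
      ∀ L R → Represents L RP → R 0 ≡ toℕ p → R 2 ≡ toℕ (unaryList L) → R 3 ≡ pc → Halts R 137 (S 0)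
    simulate (suc fuel) RP pc S h L R rep h₀ h₂ h₃ with lookupI P pc in current
    ... | inc r j =
      reaches-halts (fetch-current-spec R pc h₀ h₃ current) λ R₁ ((a₈ , a₉) , k) →
      reaches-halts (inc-exec-spec R₁ r j L a₈ a₉ (trans (regs-kept k) h₂)) λ R₂ (b₀ , b₂ , b₃) →
      simulate fuel (set RP r (suc (RP r))) j S h (setNth0 L r (suc (nth0 L r))) R₂
        (subst (λ v → Represents (setNth0 L r (suc (nth0 L r))) (set RP r (suc v))) (rep r) (represents-set r _ rep))
        (trans b₀ (trans (input-kept k) h₀)) b₂ b₃
    ... | decjz r j k with RP r in value
    ...   | zero =
      reaches-halts (fetch-current-spec R pc h₀ h₃ current) λ R₁ ((a₈ , _ , a₁₀) , kp) →
      reaches-halts (decjz-zero-exec-spec R₁ r k L a₈ a₁₀ (trans (regs-kept kp) h₂) (trans (rep r) value))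
        λ R₂ (b₀ , b₂ , b₃) →
      simulate fuel RP k S h L R₂ rep (trans b₀ (trans (input-kept kp) h₀)) (trans b₂ (trans (regs-kept kp) h₂)) b₃
    ...   | suc w =
      reaches-halts (fetch-current-spec R pc h₀ h₃ current) λ R₁ ((a₈ , a₉ , _) , kp) →
      reaches-halts (decjz-suc-exec-spec R₁ r j L w a₈ a₉ (trans (regs-kept kp) h₂) (trans (rep r) value))
        λ R₂ (b₀ , b₂ , b₃) →
      simulate fuel (set RP r w) j S h (setNth0 L r w) R₂ (represents-set r w rep)
        (trans b₀ (trans (input-kept kp) h₀)) b₂ b₃
    simulate (suc fuel) RP pc S h L R rep h₀ h₂ h₃ | orc r j k =
      reaches-halts (fetch-current-spec R pc h₀ h₃ current) λ R₁ ((_ , _ , a₁₀) , kp) →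
      reaches-halts (orc-exec-spec R₁ k a₁₀) λ R₂ (b₀ , b₂ , b₃) →
      simulate fuel RP k S h L R₂ rep (trans b₀ (trans (input-kept kp) h₀)) (trans b₂ (trans (regs-kept kp) h₂)) b₃
    simulate (suc fuel) RP pc S h L R rep h₀ h₂ h₃ | halt =
      reaches-halts (fetch-current-spec R pc h₀ h₃ current) λ R₁ (_ , kp) →
      subst (Halts R₁ 249) (trans (rep 0) (cong (λ R′ → R′ 0) (just-injective h)))
        (halt-exec-halts R₁ L (trans (regs-kept kp) h₂))

  skipProgram-spec : ∀ P f s {d} R → parseProg' f s ≡ just (P , d) → R 5 ≡ toℕ s →
    Reaches R 9 103 (λ R′ → R′ 5 ≡ toℕ d × Modifies parseInstrRegs R R′)
  skipProgram-spec P f s R parsed h₅ with parseProg'-step f s parsed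
  ... | inj₁ (e , _) = subst (λ p → Reaches R 9 (skipExit p) (λ R′ → ParsedInRegs p R′ × Modifies parseInstrRegs R R′)) e
                         (parseInstr-spec (placed (parseInstrCode 9 103 9 9 9 9) refl) s R h₅)
  ... | inj₂ (i , t , P′ , f′ , e , refl , parsed′) =
    subst (λ a → Reaches R 9 a (λ R′ → ParsedInRegs (instr i t) R′ × Modifies parseInstrRegs R R′)) (skipExit-instr i)
      (subst (λ p → Reaches R 9 (skipExit p) (λ R′ → ParsedInRegs p R′ × Modifies parseInstrRegs R R′)) e
        (parseInstr-spec (placed (parseInstrCode 9 103 9 9 9 9) refl) s R h₅)) ▷ λ R₁ (p , m) →
    reaches-map (λ R′ (a , m′) → a , modifies-trans m m′) (skipProgram-spec P′ f′ t R₁ parsed′ (parsed⇒rest i t R₁ p))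
    where
    skipExit-instr : ∀ i → skipExit (instr i t) ≡ 9
    skipExit-instr (inc _ _)     = refl
    skipExit-instr (decjz _ _ _) = refl
    skipExit-instr (orc _ _ _)   = refl
    skipExit-instr halt          = refl

  Q-halts : ∀ p {P d} f → parseProg' f p ≡ just (P , d) → ∀ n → Y n ≡ true → ∀ fuel S →
    run emptyOracle P fuel (initRegs d (firstIn Y n 0)) 0 ≡ just S → Halts (initRegs p 0) 0 (S 0)
  Q-halts p {P} {d} f parsed n yn fuel S ran =
    reaches-halts (search-spec (placed (searchCode 0 4 2) refl) n (initRegs p 0) yn) λ R₁ (a , m₁) →
    reaches-halts (copy-spec (placed (copyCode 2 0 5 19 9) refl) (λ ()) (λ ()) (λ ()) R₁) λ R₂ (b₀ , b₁ , _ , m₂) →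
    reaches-halts (skipProgram-spec P f p R₂ parsed (trans b₀ (unmodified m₁ 0 tt))) λ R₃ (c₀ , m₃) →
    reaches-halts (clear-spec (placed (clearCode 103 2) refl) R₃) λ R₄ (d₀ , m₄) →
    reaches-halts (pushUnary-spec (placed (pushUnaryCode 104 4 2 11 120) refl) (λ ()) (λ ()) (λ ()) [] R₄ d₀)
      λ R₅ (e₀ , _ , m₅) →
    reaches-halts (pushUnary-spec (placed (pushUnaryCode 120 5 2 11 136) refl) (λ ()) (λ ()) (λ ()) _ R₅ e₀)
      λ R₆ (g₀ , _ , m₆) →
    reaches-halts (clear-spec (placed (clearCode 136 3) refl) R₆) λ R₇ (h₀ , m₇) →
    Simulation.simulate {p} {P} {d} {f} parsed fuel (initRegs d (firstIn Y n 0)) 0 S ran (toℕ d ∷ firstIn Y n 0 ∷ []) R₇ (represents-initRegs d _)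
      (trans (unmodified (m₃ ⨾ m₄ ⨾ m₅ ⨾ m₆ ⨾ m₇) 0 tt) (trans b₁ (unmodified m₁ 0 tt)))
      (trans (unmodified m₇ 2 tt) (trans g₀ (cong₂ (λ a b → toℕ (unaryList (a ∷ b ∷ [])))
          (trans (unmodified (m₄ ⨾ m₅) 5 tt) c₀)
          (trans (unmodified (m₂ ⨾ m₃ ⨾ m₄) 4 tt) a))))
      h₀

-- Encoding programs

instrBits : Instr → BitString → BitString
instrBits (inc r j)     s = 0 ∷ᵘ r ∷ᵘ j ∷ᵘ s
instrBits (decjz r j k) s = 1 ∷ᵘ r ∷ᵘ j ∷ᵘ k ∷ᵘ s
instrBits (orc r j k)   s = 2 ∷ᵘ r ∷ᵘ j ∷ᵘ k ∷ᵘ s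
instrBits halt          s = 3 ∷ᵘ s

parseNat-∷ᵘ : ∀ n s → parseNat (n ∷ᵘ s) ≡ just (n , s)
parseNat-∷ᵘ zero    s = refl
parseNat-∷ᵘ (suc n) s rewrite parseNat-∷ᵘ n s = refl

∷ᵘ-++ : ∀ n x s → (n ∷ᵘ x) ++ s ≡ n ∷ᵘ (x ++ s)
∷ᵘ-++ n x s = ++-assoc (replicate n true) (false ∷ x) s

instrBits-++ : ∀ i x s → instrBits i (x ++ s) ≡ instrBits i x ++ s
instrBits-++ (inc r j) x s =
  sym (trans (∷ᵘ-++ 0 _ s) (cong (0 ∷ᵘ_) (trans (∷ᵘ-++ r _ s) (cong (r ∷ᵘ_) (∷ᵘ-++ j x s)))))
instrBits-++ (decjz r j k) x s =
  sym (trans (∷ᵘ-++ 1 _ s) (cong (1 ∷ᵘ_) (trans (∷ᵘ-++ r _ s) (cong (r ∷ᵘ_) (trans (∷ᵘ-++ j _ s) (cong (j ∷ᵘ_) (∷ᵘ-++ k x s)))))))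
instrBits-++ (orc r j k) x s =
  sym (trans (∷ᵘ-++ 2 _ s) (cong (2 ∷ᵘ_) (trans (∷ᵘ-++ r _ s) (cong (r ∷ᵘ_) (trans (∷ᵘ-++ j _ s) (cong (j ∷ᵘ_) (∷ᵘ-++ k x s)))))))
instrBits-++ halt x s = sym (∷ᵘ-++ 3 x s)

-- Opaque, since the encoding of Q is large and must not be unfolded by the type checker.
opaque
  encode : Prog → BitString → BitString
  encode []      s = false ∷ s
  encode (i ∷ P) s = true ∷ instrBits i (encode P s)

  parseProg'-encode : ∀ P s f → length P < f → parseProg' f (encode P s) ≡ just (P , s)
  parseProg'-encode [] s (suc f) _ = refl
  parseProg'-encode (inc r j ∷ P) s (suc f) (s≤s lt)
    rewrite parseNat-∷ᵘ 0 (r ∷ᵘ j ∷ᵘ encode P s) | parseNat-∷ᵘ r (j ∷ᵘ encode P s) | parseNat-∷ᵘ j (encode P s)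
          | parseProg'-encode P s f lt = refl
  parseProg'-encode (decjz r j k ∷ P) s (suc f) (s≤s lt)
    rewrite parseNat-∷ᵘ 1 (r ∷ᵘ j ∷ᵘ k ∷ᵘ encode P s) | parseNat-∷ᵘ r (j ∷ᵘ k ∷ᵘ encode P s)
          | parseNat-∷ᵘ j (k ∷ᵘ encode P s) | parseNat-∷ᵘ k (encode P s) | parseProg'-encode P s f lt = refl
  parseProg'-encode (orc r j k ∷ P) s (suc f) (s≤s lt)
    rewrite parseNat-∷ᵘ 2 (r ∷ᵘ j ∷ᵘ k ∷ᵘ encode P s) | parseNat-∷ᵘ r (j ∷ᵘ k ∷ᵘ encode P s)
          | parseNat-∷ᵘ j (k ∷ᵘ encode P s) | parseNat-∷ᵘ k (encode P s) | parseProg'-encode P s f lt = refl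
  parseProg'-encode (halt ∷ P) s (suc f) (s≤s lt)
    rewrite parseNat-∷ᵘ 3 (encode P s) | parseProg'-encode P s f lt = refl

  encode-++ : ∀ P s → encode P s ≡ encode P [] ++ s
  encode-++ []      s = refl
  encode-++ (i ∷ P) s = cong (true ∷_) (trans (cong (instrBits i) (encode-++ P s)) (instrBits-++ i (encode P []) s))

  length-encode : ∀ P s → length (encode P s) ≡ length s + length (encode P [])
  length-encode P s = trans (cong length (encode-++ P s)) (trans (length-++ (encode P [])) (+-comm _ (length s)))

  length≤length-encode : ∀ P s → length P ≤ length (encode P s)
  length≤length-encode []      s = z≤n
  length≤length-encode (i ∷ P) s = s≤s (≤-trans (length≤length-encode P s) (length≤length-instrBits (encode P s)))
    where
    length≤length-instrBits : ∀ x → length x ≤ length (instrBits i x)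
    length≤length-instrBits x rewrite instrBits-++ i [] x | length-++ (instrBits i []) {x} = m≤n+m _ _

  parseProg-encode : ∀ P s → parseProg (encode P s) ≡ just (P , s)
  parseProg-encode P s = parseProg'-encode P s _ (s≤s (length≤length-encode P s))

-- The set A

atLeast : ℕ → Subset
atLeast N n = N ≤ᵇ n

count-atLeast : ∀ N n → suc n ≤ count (atLeast N) n + N
count-atLeast zero    zero    = s≤s z≤n
count-atLeast (suc N) zero    = s≤s z≤n
count-atLeast N       (suc n) with N ≤ᵇ suc n in N≤ᵇn
... | true  = s≤s (count-atLeast N n)
... | false = ≤-trans (≰⇒> λ N≤n → subst T N≤ᵇn (≤⇒≤ᵇ N≤n)) (m≤n+m N _)

atLeast-lowerDensityOne : ∀ N → LowerDensityOne (atLeast N)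
atLeast-lowerDensityOne N q = suc q * N , λ n sqN≤n →
  let c = count (atLeast N) n in
  +-cancelʳ-≤ (suc n) (q * suc n) (suc q * c) (begin
    q * suc n + suc n        ≡⟨ +-comm (q * suc n) (suc n) ⟩
    suc q * suc n            ≤⟨ *-monoʳ-≤ (suc q) (count-atLeast N n) ⟩
    suc q * (c + N)          ≡⟨ *-distribˡ-+ (suc q) c N ⟩
    suc q * c + suc q * N    ≤⟨ +-monoʳ-≤ (suc q * c) (≤-trans sqN≤n (n≤1+n n)) ⟩
    suc q * c + suc n        ∎)
  where open ≤-Reasoning

Outputs : Subset → Prog → BitString → ℕ → BitString → Set
Outputs Y P d n σ = ∃ λ fuel → Σ Regs λ R → run Y P fuel (initRegs d n) 0 ≡ just R × fromℕ (R 0) ≡ σ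

UOut-intro : ∀ Y p n σ {P d} → parseProg p ≡ just (P , d) → Outputs Y P d n σ → UOut Y p n σ
UOut-intro Y p n σ e h with parseProg p | e
... | just _ | refl = h

UOut-elim : ∀ Y p n σ → UOut Y p n σ → Σ Prog λ P → Σ BitString λ d → parseProg p ≡ just (P , d) × Outputs Y P d n σ
UOut-elim Y p n σ u with parseProg p
... | just (P , d) = P , d , refl , u

CY≤-from-CondC≤ : ∀ σ N k → (∀ n → N ≤ n → CondC≤ σ n k) →
  ∀ Y → Infinite Y → Y ⊆ atLeast N → CY≤ Y σ (k + length (encode Q []))
CY≤-from-CondC≤ σ N k C≤k Y infinite Y⊆A =
  let (n , _ , n∈Y) = infinite 0
      m = firstIn Y n 0
      (p , |p|≤k , out) = C≤k m (≤ᵇ⇒≤ N m (subst T (sym (Y⊆A m (firstIn-∈ Y n 0 n∈Y))) tt))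
      (P , d , parsed , fuel , S , ran , S₀) = UOut-elim emptyOracle p m σ out
      (fuel′ , S′ , ran′ , S′₀) = Interpreter.Q-halts Y p (suc (length p)) parsed n n∈Y fuel S ran
  in encode Q p ,
     subst (_≤ k + length (encode Q [])) (sym (length-encode Q p)) (+-monoˡ-≤ (length (encode Q [])) |p|≤k) ,
     UOut-intro Y (encode Q p) 0 σ (parseProg-encode Q p) (fuel′ , S′ , ran′ , trans (cong fromℕ S′₀) S₀)

proposition6p2 : ∃ λ (c : ℕ) → ∀ (σ : BitString) (N : ℕ) →
    Σ Subset λ A → LowerDensityOne A ×
      (∀ (k : ℕ) → (∀ n → N ≤ n → CondC≤ σ n k) →
        ∀ (Y : Subset) → Infinite Y → Y ⊆ A → CY≤ Y σ (k + c))
proposition6p2 = length (encode Q []) , λ σ N → atLeast N , atLeast-lowerDensityOne N , CY≤-from-CondC≤ σ N
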